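{- Fix an integer $p>0$. The sequence $(a_{p,m})_{0\le m\le p}$ is symmetric ($a_{p,m}=a_{p,p-m}$) and unimodal, and for $0<m<p$, $$a_{p,m}^2\ \ge\ \Bigl(1+\frac1m\Bigr)\Bigl(1+\frac1{p-m}\Bigr)a_{p,m-1}\,a_{p,m+1},$$ i.e. $(a_{p,m})_m$ is ultra log-concave. The same statements (symmetry, unimodality and the same inequality) hold for $(c_{p,m})_{0\le m\le p}$.
   Context: For $0\le m\le p$, $a_{p,m}$ is the number of $B$-orbits on $GL_p/(GL_m\times GL_{p-m})$ ($B$ a Borel subgroup), which equals the number of $m$-matchings in the corona graph $C_p$; $c_{p,m}$ is the number of $B$-orbits on $Sp_{2p}/(Sp_{2m}\times Sp_{2p-2m})$ over an algebraically closed field of characteristic $\ne2$, which equals the number of $m$-matchings in the double corona graph $C^{(2)}_p$. Here $C_p$ has vertices $v_1,\dots,v_p,w_1,\dots,w_p$, one edge $v_iv_j$ for each $i\ne j$ and one edge $v_iw_i$ for each $i$; $C^{(2)}_p$ is the same but with two parallel edges between $v_i$ and $v_j$ for each $i\ne j$. An $m$-matching is a set of $m$ edges no two sharing a vertex. -}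

module Defs where

open import Data.Nat using (ℕ; zero; suc; _+_; _*_; _∸_; _≤_; _<_)
open import Data.Bool using (Bool; true; false; _∧_; not)
open import Data.Fin using (Fin; _<?_)
import Data.Fin as Fin
open import Data.Sum using (_⊎_; inj₁; inj₂)
open import Data.Sum.Properties using (≡-dec)
open import Data.Product using (_×_; _,_; Σ)
open import Data.List using (List; []; _∷_; _++_; map; length; filter; concatMap; allFin)
open import Relation.Nullary.Decidable using (⌊_⌋; does)
open import Relation.Binary.PropositionalEquality using (_≡_)

-- Vertices of the (double) corona graph on p: inj₁ i = v_i, inj₂ i = w_i.
Vertex : ℕ → Set
Vertex p = Fin p ⊎ Fin p

_==_ : {p : ℕ} → Vertex p → Vertex p → Bool
x == y = does (≡-dec Fin._≟_ Fin._≟_ x y)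

-- An edge is recorded by its two endpoints.  Parallel edges are distinct
-- entries (positions) of the edge list.
Edge : ℕ → Set
Edge p = Vertex p × Vertex p

vvEdges : (p : ℕ) → List (Edge p)
vvEdges p = concatMap (λ i → concatMap (λ j → if' (does (i <? j)) ((inj₁ i , inj₁ j) ∷ []) []) (allFin p)) (allFin p)
  where
  if' : {A : Set} → Bool → A → A → A
  if' true  a b = a
  if' false a b = b

vwEdges : (p : ℕ) → List (Edge p)
vwEdges p = map (λ i → (inj₁ i , inj₂ i)) (allFin p)

coronaEdges : (p : ℕ) → List (Edge p)
coronaEdges p = vvEdges p ++ vwEdges p

doubleCoronaEdges : (p : ℕ) → List (Edge p)
doubleCoronaEdges p = vvEdges p ++ vvEdges p ++ vwEdges p

-- all sub-multisets of size m, chosen by position (i.e. all m-subsets of the edge set)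
choose : {A : Set} → ℕ → List A → List (List A)
choose zero    xs       = [] ∷ []
choose (suc m) []       = []
choose (suc m) (x ∷ xs) = map (x ∷_) (choose m xs) ++ choose (suc m) xs

disjoint : {p : ℕ} → Edge p → Edge p → Bool
disjoint (a , b) (c , d) = not (a == c) ∧ not (a == d) ∧ not (b == c) ∧ not (b == d)

allB : {A : Set} → (A → Bool) → List A → Bool
allB f []       = true
allB f (x ∷ xs) = f x ∧ allB f xs

isMatching : {p : ℕ} → List (Edge p) → Bool
isMatching []       = true
isMatching (e ∷ es) = allB (disjoint e) es ∧ isMatching es

countMatchings : {p : ℕ} → ℕ → List (Edge p) → ℕ
countMatchings m es = length (filter (λ s → isMatching s Data.Bool.≟ true) (choose m es))

a : ℕ → ℕ → ℕ
a p m = countMatchings m (coronaEdges p)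

c : ℕ → ℕ → ℕ
c p m = countMatchings m (doubleCoronaEdges p)

Unimodal : (ℕ → ℕ) → ℕ → Set
Unimodal f n = Σ ℕ λ k → k ≤ n
  × (∀ i → i < k → f i ≤ f (suc i))
  × (∀ i → k ≤ i → i < n → f (suc i) ≤ f i)

Symmetric : (ℕ → ℕ) → ℕ → Set
Symmetric f n = ∀ m → m ≤ n → f m ≡ f (n ∸ m)

-- f_m^2 ≥ (1+1/m)(1+1/(n-m)) f_{m-1} f_{m+1} for 0<m<n, with denominators
-- cleared (multiplied by the positive number m(n-m)):
-- m(n-m) f_m^2 ≥ (m+1)(n-m+1) f_{m-1} f_{m+1}
UltraLogConcave : (ℕ → ℕ) → ℕ → Set
UltraLogConcave f n = ∀ m → 0 < m → m < n →
  (m + 1) * ((n ∸ m) + 1) * (f (m ∸ 1) * f (m + 1)) ≤ m * (n ∸ m) * (f m * f m)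

-- Let N(n, m) be the number of m-matchings of the corona on n vertices whose complete part has k
-- parallel edges between any two vertices (k = 1 for C_p, k = 2 for C^(2)_p).  Looking at what
-- happens to v₁ gives N(n+1, m+1) = N(n, m+1) + N(n, m) + k n N(n-1, m), and in the coordinates
-- A(m, r) = N(m + r, m) this recurrence is symmetric in m and r.  With k w = 2 one checks
-- w^m m! r! A(m, r) = (m + r)! B(m, r), where B(m, r) = Σⱼ j! C(m,j) C(r,j) w^(m-j) counts
-- w-weighted partial matchings of K_{m,r}.  Ultra log-concavity of N(p, ·) is therefore exactly
-- log-concavity of B along the antidiagonal m + r = p.  The rows and columns of B are log-concave,
-- since x ↦ (w xₙ + n xₙ₋₁)ₙ preserves log-concavity of positive sequences, and the adjacent 2×2
-- minors of B are nonnegative; together these give log-concavity along antidiagonals.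
-- Unimodality then follows from symmetry and log-concavity.

module Submission where

open import Defs
open import Data.Bool using (Bool; true; false; _∧_; _∨_; not; if_then_else_)
import Data.Bool as Bool
open import Data.Bool.Properties using (∧-comm; ∧-zeroʳ; ∨-identityʳ; not-injective)
open import Data.Nat using (ℕ; zero; suc; pred; _+_; _*_; _∸_; _^_; _!; _≤_; _<_; _≤?_; s≤s; s≤s⁻¹; z<s; s<s; >-nonZero; ⌊_/2⌋; ⌈_/2⌉)
open import Data.Nat.Properties hiding (_<?_)
open import Data.Nat.Tactic.RingSolver using (solve-∀)
open import Data.Nat.ListAction using (sum)
open import Data.Nat.ListAction.Properties using (sum-++)
import Algebra.Properties.CommutativeSemigroup as CommutativeSemigroupProperties
open CommutativeSemigroupProperties *-commutativeSemigroup using () renaming (interchange to *-interchange)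
open CommutativeSemigroupProperties +-commutativeSemigroup using (xy∙z≈xz∙y)
open import Data.List using (List; []; _∷_; _++_; [_]; map; length; filter; filterᵇ; concat; replicate; concatMap; allFin; tabulate)
open import Data.List.Properties using (filter-++; length-++; length-map; map-++; map-∘; ++-assoc; ++-identityʳ; concatMap-cong; concatMap-map; map-concatMap; concatMap-pure; map-tabulate)
open import Data.List.Relation.Unary.All using (All; []; _∷_; universal) renaming (map to All-map)
open import Data.List.Relation.Unary.All.Properties using () renaming (++⁺ to All-++⁺; map⁺ to All-map⁺)
open import Data.List.Relation.Binary.Permutation.Propositional as ↭ using (_↭_; module PermutationReasoning)
import Data.List.Relation.Binary.Permutation.Propositional.Properties as ↭ₚ
open import Data.Fin using (Fin; _<?_) renaming (zero to fzero; suc to fsuc)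
import Data.Fin as Fin
open import Data.Sum using (inj₁; inj₂)
import Data.Sum as Sum
open import Data.Sum.Properties using (≡-dec)
open import Data.Product using (_×_; _,_; proj₁; proj₂)
open import Data.Empty using (⊥-elim)
open import Function using (_∘_; id)
open import Function.Bundles using (mk⇔)
open import Relation.Nullary using (yes; no)
open import Relation.Nullary.Decidable using (does; dec-true; does-⇔)
open import Relation.Binary.PropositionalEquality using (_≡_; _≗_; refl; sym; trans; cong; cong₂; subst; subst₂; module ≡-Reasoning)

-- Log-concave sequences

*-positive : ∀ {m n} → 0 < m → 0 < n → 0 < m * n
*-positive {suc m} {suc n} _ _ = z<s

Positive : (ℕ → ℕ) → Set
Positive x = ∀ n → 0 < x n

LogConcave : (ℕ → ℕ) → Set
LogConcave x = ∀ n → x n * x (2 + n) ≤ x (1 + n) * x (1 + n)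

LogConcave-resp-≗ : ∀ {x y : ℕ → ℕ} → x ≗ y → LogConcave x → LogConcave y
LogConcave-resp-≗ x≗y lc n =
  subst₂ _≤_ (cong₂ _*_ (x≗y n) (x≗y (2 + n))) (cong₂ _*_ (x≗y (1 + n)) (x≗y (1 + n))) (lc n)

logConcave-outer : ∀ {x} → Positive x → LogConcave x →
                   ∀ n → x n * x (3 + n) ≤ x (1 + n) * x (2 + n)
logConcave-outer {x} pos lc n =
  *-cancelʳ-≤ _ _ (x₁ * x₂) {{>-nonZero (*-positive (pos (1 + n)) (pos (2 + n)))}} (begin
    (x₀ * x₃) * (x₁ * x₂)  ≡⟨ regroup x₀ x₁ x₂ x₃ ⟩
    (x₀ * x₂) * (x₁ * x₃)  ≤⟨ *-mono-≤ (lc n) (lc (1 + n)) ⟩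
    (x₁ * x₁) * (x₂ * x₂)  ≡⟨ *-interchange x₁ x₁ x₂ x₂ ⟩
    (x₁ * x₂) * (x₁ * x₂)  ∎)
  where
  open ≤-Reasoning
  x₀ = x n
  x₁ = x (1 + n)
  x₂ = x (2 + n)
  x₃ = x (3 + n)
  regroup : ∀ a b c d → (a * d) * (b * c) ≡ (a * c) * (b * d)
  regroup = solve-∀

-- If x n counts w-weighted partial matchings of K_{m,n}, then extend w x n counts those of
-- K_{m+1,n}: the new vertex is unmatched (weight w) or matched to one of the n others.
extend : ℕ → (ℕ → ℕ) → ℕ → ℕ
extend w x zero    = w * x 0
extend w x (suc n) = w * x (suc n) + suc n * x n

extend-positive : ∀ {w x} → 0 < w → Positive x → Positive (extend w x)
extend-positive w>0 pos zero    = *-positive w>0 (pos 0)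
extend-positive w>0 pos (suc n) = ≤-trans (*-positive w>0 (pos (suc n))) (m≤m+n _ _)

extend-logConcave : ∀ {w x} → Positive x → LogConcave x → LogConcave (extend w x)
extend-logConcave {w} {x} pos lc zero = begin
  (w * x₀) * (w * x₂ + 2 * x₁)                    ≡⟨ expand w x₀ x₁ x₂ ⟩
  w * w * (x₀ * x₂) + 2 * w * (x₀ * x₁)           ≤⟨ +-monoˡ-≤ _ (*-monoʳ-≤ (w * w) (lc 0)) ⟩
  w * w * (x₁ * x₁) + 2 * w * (x₀ * x₁)           ≤⟨ m≤m+n _ _ ⟩
  w * w * (x₁ * x₁) + 2 * w * (x₀ * x₁) + x₀ * x₀ ≡⟨ square w x₀ x₁ ⟩
  (w * x₁ + 1 * x₀) * (w * x₁ + 1 * x₀)           ∎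
  where
  open ≤-Reasoning
  x₀ = x 0
  x₁ = x 1
  x₂ = x 2
  expand : ∀ w a b c → (w * a) * (w * c + 2 * b) ≡ w * w * (a * c) + 2 * w * (a * b)
  expand = solve-∀
  square : ∀ w a b → w * w * (b * b) + 2 * w * (a * b) + a * a ≡ (w * b + 1 * a) * (w * b + 1 * a)
  square = solve-∀
extend-logConcave {w} {x} pos lc (suc k) = begin
  (w * x₁ + j * x₀) * (w * x₃ + (2 + j) * x₂)
    ≡⟨ expand w j x₀ x₁ x₂ x₃ ⟩
  w * w * (x₁ * x₃) + (w * (2 + j) * (x₁ * x₂) + w * j * (x₀ * x₃)) + j * (2 + j) * (x₀ * x₂)
    ≤⟨ +-mono-≤ (+-mono-≤ (*-monoʳ-≤ (w * w) (lc (1 + k)))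
                          (+-monoʳ-≤ (w * (2 + j) * (x₁ * x₂)) (*-monoʳ-≤ (w * j) (logConcave-outer pos lc k))))
                (*-monoʳ-≤ (j * (2 + j)) (lc k)) ⟩
  w * w * (x₂ * x₂) + (w * (2 + j) * (x₁ * x₂) + w * j * (x₁ * x₂)) + j * (2 + j) * (x₁ * x₁)
    ≤⟨ m≤m+n _ _ ⟩
  w * w * (x₂ * x₂) + (w * (2 + j) * (x₁ * x₂) + w * j * (x₁ * x₂)) + j * (2 + j) * (x₁ * x₁) + x₁ * x₁
    ≡⟨ square w j x₁ x₂ ⟩
  (w * x₂ + (1 + j) * x₁) * (w * x₂ + (1 + j) * x₁) ∎
  where
  open ≤-Reasoning
  j = suc k
  x₀ = x k
  x₁ = x (1 + k)
  x₂ = x (2 + k)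
  x₃ = x (3 + k)
  expand : ∀ w j a b c d → (w * b + j * a) * (w * d + (2 + j) * c)
         ≡ w * w * (b * d) + (w * (2 + j) * (b * c) + w * j * (a * d)) + j * (2 + j) * (a * c)
  expand = solve-∀
  square : ∀ w j b c → w * w * (c * c) + (w * (2 + j) * (b * c) + w * j * (b * c)) + j * (2 + j) * (b * b) + b * b
         ≡ (w * c + (1 + j) * b) * (w * c + (1 + j) * b)
  square = solve-∀

extend-minor : ∀ {w x} → LogConcave x → ∀ n → x (1 + n) * extend w x n ≤ x n * extend w x (1 + n)
extend-minor {w} {x} lc zero = begin
  x 1 * (w * x 0)                     ≤⟨ m≤m+n _ _ ⟩
  x 1 * (w * x 0) + x 0 * (1 * x 0)   ≡⟨ collect w (x 0) (x 1) ⟩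
  x 0 * (w * x 1 + 1 * x 0)           ∎
  where
  open ≤-Reasoning
  collect : ∀ w a b → b * (w * a) + a * (1 * a) ≡ a * (w * b + 1 * a)
  collect = solve-∀
extend-minor {w} {x} lc (suc n) = begin
  x₂ * (w * x₁ + (1 + n) * x₀)           ≡⟨ expand w n x₀ x₁ x₂ ⟩
  w * (x₂ * x₁) + (1 + n) * (x₀ * x₂)     ≤⟨ +-monoʳ-≤ (w * (x₂ * x₁)) (*-mono-≤ (n≤1+n (1 + n)) (lc n)) ⟩
  w * (x₂ * x₁) + (2 + n) * (x₁ * x₁)     ≡⟨ collect w n x₁ x₂ ⟩
  x₁ * (w * x₂ + (2 + n) * x₁)           ∎
  where
  open ≤-Reasoning
  x₀ = x n
  x₁ = x (1 + n)
  x₂ = x (2 + n)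
  expand : ∀ w n a b c → c * (w * b + (1 + n) * a) ≡ w * (c * b) + (1 + n) * (a * c)
  expand = solve-∀
  collect : ∀ w n b c → w * (c * b) + (2 + n) * (b * b) ≡ b * (w * c + (2 + n) * b)
  collect = solve-∀

antidiagonal-logConcave : ∀ {T : ℕ → ℕ → ℕ} → (∀ m r → 0 < T m r) →
  (∀ r → LogConcave (λ m → T m r)) → (∀ m → LogConcave (T m)) →
  (∀ m r → T m (1 + r) * T (1 + m) r ≤ T m r * T (1 + m) (1 + r)) →
  ∀ k l → T k (2 + l) * T (2 + k) l ≤ T (1 + k) (1 + l) * T (1 + k) (1 + l)
antidiagonal-logConcave {T} pos columns rows minor k l =
  *-cancelʳ-≤ _ _ (Y * Y) {{>-nonZero (*-positive (pos (1 + k) (1 + l)) (pos (1 + k) (1 + l)))}} (begin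
    (T k (2 + l) * T (2 + k) l) * (Y * Y)
      ≡⟨ regroup (T k (2 + l)) (T (2 + k) l) Y ⟩
    (T k (2 + l) * Y) * (Y * T (2 + k) l)
      ≤⟨ *-mono-≤ (minor k (1 + l)) (minor (1 + k) l) ⟩
    (T k (1 + l) * T (1 + k) (2 + l)) * (T (1 + k) l * T (2 + k) (1 + l))
      ≡⟨ swap-middle (T k (1 + l)) (T (1 + k) (2 + l)) (T (1 + k) l) (T (2 + k) (1 + l)) ⟩
    (T k (1 + l) * T (2 + k) (1 + l)) * (T (1 + k) l * T (1 + k) (2 + l))
      ≤⟨ *-mono-≤ (columns (1 + l) k) (rows (1 + k) l) ⟩
    (Y * Y) * (Y * Y) ∎)
  where
  open ≤-Reasoning
  Y = T (1 + k) (1 + l)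
  regroup : ∀ a d y → (a * d) * (y * y) ≡ (a * y) * (y * d)
  regroup = solve-∀
  swap-middle : ∀ a b c d → (a * b) * (c * d) ≡ (a * d) * (c * b)
  swap-middle = solve-∀

ultraLogConcave⇒logConcave : ∀ {f n} → UltraLogConcave f n →
  ∀ i → 2 + i ≤ n → f i * f (2 + i) ≤ f (1 + i) * f (1 + i)
ultraLogConcave⇒logConcave {f} {n} ulc i 2+i≤n =
  *-cancelˡ-≤ outer {{>-nonZero (*-positive {suc i + 1} z<s (subst (0 <_) (+-comm 1 (n ∸ suc i)) z<s))}} (begin
    outer * (f i * f (2 + i))          ≡⟨ cong (λ j → outer * (f i * f j)) (+-comm 1 (suc i)) ⟩
    outer * (f i * f (suc i + 1))      ≤⟨ ulc (suc i) z<s 2+i≤n ⟩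
    inner * (f (1 + i) * f (1 + i))    ≤⟨ *-monoˡ-≤ _ (*-mono-≤ (m≤m+n (suc i) 1) (m≤m+n (n ∸ suc i) 1)) ⟩
    outer * (f (1 + i) * f (1 + i))    ∎)
  where
  open ≤-Reasoning
  inner = suc i * (n ∸ suc i)
  outer = (suc i + 1) * ((n ∸ suc i) + 1)

module _ {f : ℕ → ℕ} {p : ℕ} (f>0 : ∀ m → m ≤ p → 0 < f m)
         (lc : ∀ n → 2 + n ≤ p → f n * f (2 + n) ≤ f (1 + n) * f (1 + n)) where

  descent-continues : ∀ n → 2 + n ≤ p → f (1 + n) < f n → f (2 + n) < f (1 + n)
  descent-continues n 2+n≤p fall = *-cancelˡ-< (f n) _ _ (begin-strict
    f n * f (2 + n)        ≤⟨ lc n 2+n≤p ⟩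
    f (1 + n) * f (1 + n)  <⟨ *-monoˡ-< (f (1 + n)) {{>-nonZero (f>0 (1 + n) (<⇒≤ 2+n≤p))}} fall ⟩
    f n * f (1 + n)        ∎)
    where open ≤-Reasoning

  descent-persists : ∀ {n} → f (1 + n) < f n → ∀ j → n < j → j ≤ p → f j < f (pred j) × f j < f n
  descent-persists fall (suc j) n<1+j 1+j≤p with m≤n⇒m<n∨m≡n (s≤s⁻¹ n<1+j)
  ... | inj₂ refl = fall , fall
  descent-persists fall (suc (suc j)) _ 2+j≤p | inj₁ n<1+j =
    let (fallⱼ , belowⱼ) = descent-persists fall (suc j) n<1+j (<⇒≤ 2+j≤p)
        fall′ = descent-continues j 2+j≤p fallⱼ
    in fall′ , <-trans fall′ belowⱼ

  module _ (sym-f : Symmetric f p) where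

    -- A descent at i would persist up to p ∸ i > i, contradicting f i ≡ f (p ∸ i).
    rises-below-middle : ∀ i → i + i < p → f i ≤ f (1 + i)
    rises-below-middle i 2i<p with f i ≤? f (1 + i)
    ... | yes rise = rise
    ... | no ¬rise = ⊥-elim (<-irrefl (sym (sym-f i (≤-trans (m≤m+n i i) (<⇒≤ 2i<p))))
                       (proj₂ (descent-persists (≰⇒> ¬rise) (p ∸ i) (m+n≤o⇒m≤o∸n (suc i) 2i<p) (m∸n≤m p i))))

    falls-above-middle : ∀ i → ⌊ p /2⌋ ≤ i → i < p → f (1 + i) ≤ f i
    falls-above-middle i half≤i i<p = begin
      f (1 + i)   ≡⟨ sym-f (1 + i) i<p ⟩
      f j         ≤⟨ rises-below-middle j 2j<p ⟩
      f (1 + j)   ≡⟨ cong f (sym (+-∸-assoc 1 i<p)) ⟩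
      f (p ∸ i)   ≡⟨ sym (sym-f i (<⇒≤ i<p)) ⟩
      f i         ∎
      where
      open ≤-Reasoning
      j = p ∸ suc i
      j≤i : j ≤ i
      j≤i = m≤n+o⇒m∸n≤o p (suc i) (begin
        p                    ≡⟨ sym (⌊n/2⌋+⌈n/2⌉≡n p) ⟩
        ⌊ p /2⌋ + ⌈ p /2⌉    ≤⟨ +-mono-≤ half≤i (⌊n/2⌋-mono (n≤1+n (suc p))) ⟩
        i + suc ⌊ p /2⌋      ≤⟨ +-monoʳ-≤ i (s≤s half≤i) ⟩
        i + suc i            ≡⟨ +-suc i i ⟩
        suc (i + i)          ∎)
      2j<p : j + j < p
      2j<p = begin-strict
        j + j       ≤⟨ +-monoˡ-≤ j j≤i ⟩
        i + j       <⟨ ≤-refl ⟩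
        suc i + j   ≡⟨ m+[n∸m]≡n i<p ⟩
        p           ∎

    logConcave∧symmetric⇒unimodal : Unimodal f p
    logConcave∧symmetric⇒unimodal = ⌊ p /2⌋ , ⌊n/2⌋≤n p , rises , falls-above-middle
      where
      open ≤-Reasoning
      rises : ∀ i → i < ⌊ p /2⌋ → f i ≤ f (1 + i)
      rises i i<half = rises-below-middle i (begin-strict
        i + i               <⟨ +-mono-<-≤ i<half (<⇒≤ i<half) ⟩
        ⌊ p /2⌋ + ⌊ p /2⌋   ≤⟨ +-monoʳ-≤ ⌊ p /2⌋ (⌊n/2⌋≤⌈n/2⌉ p) ⟩
        ⌊ p /2⌋ + ⌈ p /2⌉   ≡⟨ ⌊n/2⌋+⌈n/2⌉≡n p ⟩
        p                   ∎)

module _ {f g : ℕ → ℕ} {p : ℕ} (f≗g : f ≗ g) where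

  Symmetric-resp-≗ : Symmetric g p → Symmetric f p
  Symmetric-resp-≗ sym-g m m≤p = trans (f≗g m) (trans (sym-g m m≤p) (sym (f≗g (p ∸ m))))

  Unimodal-resp-≗ : Unimodal g p → Unimodal f p
  Unimodal-resp-≗ (k , k≤p , rises , falls) =
    k , k≤p , (λ i i<k → subst₂ _≤_ (sym (f≗g i)) (sym (f≗g (suc i))) (rises i i<k))
            , (λ i k≤i i<p → subst₂ _≤_ (sym (f≗g (suc i))) (sym (f≗g i)) (falls i k≤i i<p))

  UltraLogConcave-resp-≗ : UltraLogConcave g p → UltraLogConcave f p
  UltraLogConcave-resp-≗ ulc m 0<m m<p =
    subst₂ _≤_ (cong ((m + 1) * ((p ∸ m) + 1) *_) (sym (cong₂ _*_ (f≗g (m ∸ 1)) (f≗g (m + 1)))))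
               (cong (m * (p ∸ m) *_) (sym (cong₂ _*_ (f≗g m) (f≗g m))))
               (ulc m 0<m m<p)

  properties-resp-≗ : Symmetric g p × Unimodal g p × UltraLogConcave g p → Symmetric f p × Unimodal f p × UltraLogConcave f p
  properties-resp-≗ (sym-g , uni-g , ulc-g) = Symmetric-resp-≗ sym-g , Unimodal-resp-≗ uni-g , UltraLogConcave-resp-≗ ulc-g

-- Weighted rook numbers

-- rook w m r = Σⱼ j! C(m,j) C(r,j) w^(m-j), the w-weighted partial matchings of K_{m,r}.
rook : ℕ → ℕ → ℕ → ℕ
rook w zero    r = 1
rook w (suc m) r = extend w (rook w m) r

rook-positive : ∀ {w} → 0 < w → ∀ m → Positive (rook w m)
rook-positive w>0 zero    r = z<s
rook-positive w>0 (suc m) r = extend-positive w>0 (rook-positive w>0 m) r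

rook-zero : ∀ w m → rook w m 0 ≡ w ^ m
rook-zero w zero    = refl
rook-zero w (suc m) = cong (w *_) (rook-zero w m)

rook-suc-suc : ∀ w m r → rook w (suc m) (suc r) ≡ rook w (suc m) r + suc m * rook w m r
rook-suc-suc w zero zero          = refl
rook-suc-suc w zero (suc r)       = shift w r
  where
  shift : ∀ w r → w * 1 + (2 + r) * 1 ≡ (w * 1 + (1 + r) * 1) + 1 * 1
  shift = solve-∀
rook-suc-suc w (suc m) zero = begin
  w * rook w (1 + m) 1 + 1 * rook w (1 + m) 0   ≡⟨ cong (λ t → w * t + 1 * rook w (1 + m) 0) (rook-suc-suc w m 0) ⟩
  w * (w * X + (1 + m) * X) + 1 * (w * X)       ≡⟨ collect w m X ⟩
  w * (w * X) + (2 + m) * (w * X)               ∎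
  where
  open ≡-Reasoning
  X = rook w m 0
  collect : ∀ w m X → w * (w * X + (1 + m) * X) + 1 * (w * X) ≡ w * (w * X) + (2 + m) * (w * X)
  collect = solve-∀
rook-suc-suc w (suc m) (suc r) =
  trans (cong (λ t → w * t + (2 + r) * rook w (1 + m) (1 + r)) (rook-suc-suc w m (suc r)))
        (exchange w (suc m) (suc r) _ _ _ _ (rook-suc-suc w m r) refl)
  where
  -- Both sides equal w Y + a w U + Y + b Z + a b V, using one expansion of Y on each side.
  exchange : ∀ w a b Y Z U V → Y ≡ Z + a * V → Y ≡ w * U + b * V →
             w * (Y + a * U) + suc b * Y ≡ (w * Y + b * Z) + suc a * Y
  exchange w a b Y Z U V Y≡Z+aV Y≡wU+bV = begin
    w * (Y + a * U) + suc b * Y             ≡⟨ open-up w a b Y U ⟩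
    w * Y + Y + a * (w * U) + b * Y         ≡⟨ cong (λ t → w * Y + Y + a * (w * U) + b * t) Y≡Z+aV ⟩
    w * Y + Y + a * (w * U) + b * (Z + a * V) ≡⟨ regroup w a b Y Z U V ⟩
    w * Y + b * Z + Y + a * (w * U + b * V) ≡⟨ cong (λ t → w * Y + b * Z + Y + a * t) (sym Y≡wU+bV) ⟩
    w * Y + b * Z + Y + a * Y               ≡⟨ close-up w a b Y Z ⟩
    (w * Y + b * Z) + suc a * Y             ∎
    where
    open ≡-Reasoning
    open-up : ∀ w a b Y U → w * (Y + a * U) + suc b * Y ≡ w * Y + Y + a * (w * U) + b * Y
    open-up = solve-∀
    regroup : ∀ w a b Y Z U V → w * Y + Y + a * (w * U) + b * (Z + a * V) ≡ w * Y + b * Z + Y + a * (w * U + b * V)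
    regroup = solve-∀
    close-up : ∀ w a b Y Z → w * Y + b * Z + Y + a * Y ≡ (w * Y + b * Z) + suc a * Y
    close-up = solve-∀

rook-logConcaveʳ : ∀ {w} → 0 < w → ∀ m → LogConcave (rook w m)
rook-logConcaveʳ w>0 zero    n = ≤-refl
rook-logConcaveʳ w>0 (suc m) = extend-logConcave (rook-positive w>0 m) (rook-logConcaveʳ w>0 m)

rook-logConcaveˡ : ∀ {w} → 0 < w → ∀ r → LogConcave (λ m → rook w m r)
rook-logConcaveˡ {w} w>0 zero n = ≤-reflexive (geometric w (rook w n 0))
  where
  geometric : ∀ w x → x * (w * (w * x)) ≡ (w * x) * (w * x)
  geometric = solve-∀
rook-logConcaveˡ {w} w>0 (suc r) =
  LogConcave-resp-≗ column (extend-logConcave (λ m → rook-positive w>0 m r) (rook-logConcaveˡ w>0 r))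
  where
  column : ∀ m → extend 1 (λ m → rook w m r) m ≡ rook w m (suc r)
  column zero    = *-identityˡ 1
  column (suc m) = trans (cong (_+ suc m * rook w m r) (*-identityˡ (rook w (suc m) r))) (sym (rook-suc-suc w m r))

rook-minor : ∀ {w} → 0 < w → ∀ m r → rook w m (1 + r) * rook w (1 + m) r ≤ rook w m r * rook w (1 + m) (1 + r)
rook-minor {w} w>0 m = extend-minor {w} {rook w m} (rook-logConcaveʳ w>0 m)

rook-antidiagonal : ∀ {w} → 0 < w → ∀ k l →
  rook w k (2 + l) * rook w (2 + k) l ≤ rook w (1 + k) (1 + l) * rook w (1 + k) (1 + l)
rook-antidiagonal w>0 = antidiagonal-logConcave (rook-positive w>0) (rook-logConcaveˡ w>0) (rook-logConcaveʳ w>0) (rook-minor w>0)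

-- Matching numbers of coronas

coronaTable : ℕ → ℕ → ℕ → ℕ
coronaTable k zero    r       = 1
coronaTable k (suc m) zero    = 1
coronaTable k (suc m) (suc r) = coronaTable k (suc m) r + coronaTable k m (suc r) + k * suc (m + r) * coronaTable k m r

coronaTable-positive : ∀ k m r → 0 < coronaTable k m r
coronaTable-positive k zero    r       = z<s
coronaTable-positive k (suc m) zero    = z<s
coronaTable-positive k (suc m) (suc r) = ≤-trans (coronaTable-positive k (suc m) r) (≤-trans (m≤m+n _ _) (m≤m+n _ _))

coronaTable-sym : ∀ k m r → coronaTable k m r ≡ coronaTable k r m
coronaTable-sym k zero    zero    = refl
coronaTable-sym k zero    (suc r) = refl
coronaTable-sym k (suc m) zero    = refl
coronaTable-sym k (suc m) (suc r) = begin
  T (suc m) r + T m (suc r) + k * suc (m + r) * T m r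
    ≡⟨ cong₂ (λ x y → x + y + k * suc (m + r) * T m r) (coronaTable-sym k (suc m) r) (coronaTable-sym k m (suc r)) ⟩
  T r (suc m) + T (suc r) m + k * suc (m + r) * T m r
    ≡⟨ cong₂ (λ x y → T r (suc m) + T (suc r) m + k * suc x * y) (+-comm m r) (coronaTable-sym k m r) ⟩
  T r (suc m) + T (suc r) m + k * suc (r + m) * T r m
    ≡⟨ cong (_+ k * suc (r + m) * T r m) (+-comm (T r (suc m)) (T (suc r) m)) ⟩
  T (suc r) m + T r (suc m) + k * suc (r + m) * T r m ∎
  where
  open ≡-Reasoning
  T = coronaTable k

module _ {k w : ℕ} (k*w≡2 : k * w ≡ 2) where

  w>0 : 0 < w
  w>0 = n≢0⇒n>0 (λ w≡0 → 0≢1+n (trans (sym (*-zeroʳ k)) (trans (cong (k *_) (sym w≡0)) k*w≡2)))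

  rook-coronaTable : ∀ m r → w ^ m * (m ! * r !) * coronaTable k m r ≡ (m + r) ! * rook w m r
  rook-coronaTable zero    r    = unit (r !)
    where
    unit : ∀ x → 1 * (1 * x) * 1 ≡ x * 1
    unit = solve-∀
  rook-coronaTable (suc m) zero = begin
    w ^ suc m * (suc m ! * 1) * 1    ≡⟨ unit (w ^ suc m) (suc m !) ⟩
    suc m ! * w ^ suc m              ≡⟨ cong₂ (λ n x → n ! * x) (sym (+-identityʳ (suc m))) (sym (rook-zero w (suc m))) ⟩
    (suc m + 0) ! * rook w (suc m) 0 ∎
    where
    open ≡-Reasoning
    unit : ∀ W F → W * (F * 1) * 1 ≡ F * W
    unit = solve-∀
  rook-coronaTable (suc m) (suc r) = begin
    w * W * ((1 + m) * M * ((1 + r) * R)) * (T (1 + m) r + T m (1 + r) + k * (1 + m + r) * T m r)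
      ≡⟨ distribute k w m r W M R (T (1 + m) r) (T m (1 + r)) (T m r) ⟩
    (1 + r) * (w ^ (1 + m) * ((1 + m) ! * r !) * T (1 + m) r)
      + w * (1 + m) * (w ^ m * (m ! * (1 + r) !) * T m (1 + r))
      + (k * w) * (1 + m) * (1 + r) * (1 + m + r) * (w ^ m * (m ! * r !) * T m r)
      ≡⟨ cong₂ _+_ (cong₂ _+_ (cong ((1 + r) *_) (rook-coronaTable (suc m) r))
                               (cong (w * (1 + m) *_) (trans (rook-coronaTable m (suc r)) (cong (λ n → n ! * rook w m (1 + r)) (+-suc m r)))))
                   (cong₂ (λ x y → x * (1 + m) * (1 + r) * (1 + m + r) * y) k*w≡2 (rook-coronaTable m r)) ⟩
    (1 + r) * ((1 + m + r) * P * rook w (1 + m) r)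
      + w * (1 + m) * ((1 + m + r) * P * rook w m (1 + r))
      + 2 * (1 + m) * (1 + r) * (1 + m + r) * (P * rook w m r)
      ≡⟨ factor w m r P (rook w (1 + m) r) (rook w m (1 + r)) (rook w m r) ⟩
    (1 + m + r) * P * ((1 + r) * (rook w (1 + m) r + (1 + m) * rook w m r) + (1 + m) * rook w (1 + m) (1 + r))
      ≡⟨ cong (λ x → (1 + m + r) * P * ((1 + r) * x + (1 + m) * rook w (1 + m) (1 + r))) (sym (rook-suc-suc w m r)) ⟩
    (1 + m + r) * P * ((1 + r) * rook w (1 + m) (1 + r) + (1 + m) * rook w (1 + m) (1 + r))
      ≡⟨ collect m r P (rook w (1 + m) (1 + r)) ⟩
    (2 + m + r) ! * rook w (1 + m) (1 + r)
      ≡⟨ cong (λ n → suc n ! * rook w (1 + m) (1 + r)) (sym (+-suc m r)) ⟩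
    (suc m + suc r) ! * rook w (1 + m) (1 + r) ∎
    where
    open ≡-Reasoning
    T = coronaTable k
    W = w ^ m
    M = m !
    R = r !
    P = (m + r) !
    distribute : ∀ k w m r W M R X Y Z →
      w * W * ((1 + m) * M * ((1 + r) * R)) * (X + Y + k * (1 + m + r) * Z)
      ≡ (1 + r) * (w * W * ((1 + m) * M * R) * X) + w * (1 + m) * (W * (M * ((1 + r) * R)) * Y)
        + (k * w) * (1 + m) * (1 + r) * (1 + m + r) * (W * (M * R) * Z)
    distribute = solve-∀
    factor : ∀ w m r P X Y Z →
      (1 + r) * ((1 + m + r) * P * X) + w * (1 + m) * ((1 + m + r) * P * Y) + 2 * (1 + m) * (1 + r) * (1 + m + r) * (P * Z)
      ≡ (1 + m + r) * P * ((1 + r) * (X + (1 + m) * Z) + (1 + m) * (w * Y + (1 + r) * Z))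
    factor = solve-∀
    collect : ∀ m r P Y → (1 + m + r) * P * ((1 + r) * Y + (1 + m) * Y) ≡ (2 + m + r) * ((1 + m + r) * P) * Y
    collect = solve-∀

  coronaTable-ultraLogConcave : ∀ i o →
    (2 + i) * (2 + o) * (coronaTable k i (2 + o) * coronaTable k (2 + i) o)
      ≤ (1 + i) * (1 + o) * (coronaTable k (1 + i) (1 + o) * coronaTable k (1 + i) (1 + o))
  -- Multiplied by D₃ * D₃, this becomes rook-antidiagonal through rook-coronaTable.
  coronaTable-ultraLogConcave i o = *-cancelʳ-≤ _ _ (D₃ * D₃) {{>-nonZero (*-positive D₃>0 D₃>0)}} (begin
    (2 + i) * (2 + o) * (T₁ * T₂) * (D₃ * D₃)   ≡⟨ reorder₁ ((2 + i) * (2 + o)) T₁ T₂ D₃ ⟩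
    (T₁ * T₂) * ((2 + i) * (2 + o) * (D₃ * D₃)) ≡⟨ cong ((T₁ * T₂) *_) (sym denominators) ⟩
    (T₁ * T₂) * ((1 + i) * (1 + o) * (D₁ * D₂)) ≡⟨ reorder₂ ((1 + i) * (1 + o)) T₁ T₂ D₁ D₂ ⟩
    (1 + i) * (1 + o) * ((D₁ * T₁) * (D₂ * T₂)) ≡⟨ cong₂ (λ x y → (1 + i) * (1 + o) * (x * y)) D₁T₁ D₂T₂ ⟩
    (1 + i) * (1 + o) * ((P * B₁) * (P * B₂)) ≡⟨ cong ((1 + i) * (1 + o) *_) (*-interchange P B₁ P B₂) ⟩
    (1 + i) * (1 + o) * ((P * P) * (B₁ * B₂)) ≤⟨ *-monoʳ-≤ ((1 + i) * (1 + o)) (*-monoʳ-≤ (P * P) (rook-antidiagonal w>0 i o)) ⟩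
    (1 + i) * (1 + o) * ((P * P) * (B₃ * B₃)) ≡⟨ cong ((1 + i) * (1 + o) *_) (*-interchange P P B₃ B₃) ⟩
    (1 + i) * (1 + o) * ((P * B₃) * (P * B₃)) ≡⟨ cong (λ x → (1 + i) * (1 + o) * (x * x)) (sym D₃T₃) ⟩
    (1 + i) * (1 + o) * ((D₃ * T₃) * (D₃ * T₃)) ≡⟨ reorder₃ ((1 + i) * (1 + o)) T₃ D₃ ⟩
    (1 + i) * (1 + o) * (T₃ * T₃) * (D₃ * D₃) ∎)
    where
    open ≤-Reasoning
    D : ℕ → ℕ → ℕ
    D m r = w ^ m * (m ! * r !)
    T₁ = coronaTable k i (2 + o)
    T₂ = coronaTable k (2 + i) o
    T₃ = coronaTable k (1 + i) (1 + o)
    D₁ = D i (2 + o)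
    D₂ = D (2 + i) o
    D₃ = D (1 + i) (1 + o)
    B₁ = rook w i (2 + o)
    B₂ = rook w (2 + i) o
    B₃ = rook w (1 + i) (1 + o)
    P = (2 + i + o) !
    D₃>0 : 0 < D₃
    D₃>0 = *-positive (m^n>0 w {{>-nonZero w>0}} (1 + i)) (*-positive (1≤n! (1 + i)) (1≤n! (1 + o)))
    denominators : (1 + i) * (1 + o) * (D₁ * D₂) ≡ (2 + i) * (2 + o) * (D₃ * D₃)
    denominators = factorials w i o (w ^ i) (i !) (o !)
      where
      factorials : ∀ w i o W I O →
        (1 + i) * (1 + o) * ((W * (I * ((2 + o) * ((1 + o) * O)))) * (w * (w * W) * ((2 + i) * ((1 + i) * I) * O)))
        ≡ (2 + i) * (2 + o) * ((w * W * ((1 + i) * I * ((1 + o) * O))) * (w * W * ((1 + i) * I * ((1 + o) * O))))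
      factorials = solve-∀
    reorder₁ : ∀ c T₁ T₂ D → c * (T₁ * T₂) * (D * D) ≡ (T₁ * T₂) * (c * (D * D))
    reorder₁ = solve-∀
    reorder₂ : ∀ c T₁ T₂ D₁ D₂ → (T₁ * T₂) * (c * (D₁ * D₂)) ≡ c * ((D₁ * T₁) * (D₂ * T₂))
    reorder₂ = solve-∀
    reorder₃ : ∀ c T D → c * ((D * T) * (D * T)) ≡ c * (T * T) * (D * D)
    reorder₃ = solve-∀
    D₁T₁ : D₁ * T₁ ≡ P * B₁
    D₁T₁ = trans (rook-coronaTable i (2 + o)) (cong (λ n → n ! * B₁) (trans (+-suc i (1 + o)) (cong suc (+-suc i o))))
    D₂T₂ : D₂ * T₂ ≡ P * B₂
    D₂T₂ = rook-coronaTable (2 + i) o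
    D₃T₃ : D₃ * T₃ ≡ P * B₃
    D₃T₃ = trans (rook-coronaTable (1 + i) (1 + o)) (cong (λ n → suc n ! * B₃) (+-suc i o))

-- v₁ is unmatched, matched to w₁, or matched to one of the n other vᵢ by one of k parallel edges.
coronaNumber : ℕ → ℕ → ℕ → ℕ
coronaNumber k n       zero    = 1
coronaNumber k zero    (suc m) = 0
coronaNumber k (suc n) (suc m) = coronaNumber k n (suc m) + coronaNumber k n m + k * n * coronaNumber k (pred n) m

coronaNumber-above : ∀ k n m → n < m → coronaNumber k n m ≡ 0
coronaNumber-above k zero    (suc m) _         = refl
coronaNumber-above k (suc n) (suc m) (s<s n<m) = begin
  coronaNumber k n (suc m) + coronaNumber k n m + k * n * coronaNumber k (pred n) m
    ≡⟨ cong₂ (λ x y → x + y + k * n * coronaNumber k (pred n) m)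
             (coronaNumber-above k n (suc m) (m<n⇒m<1+n n<m)) (coronaNumber-above k n m n<m) ⟩
  k * n * coronaNumber k (pred n) m
    ≡⟨ cong (k * n *_) (coronaNumber-above k (pred n) m (≤-<-trans pred[n]≤n n<m)) ⟩
  k * n * 0 ≡⟨ *-zeroʳ (k * n) ⟩
  0 ∎
  where open ≡-Reasoning

coronaNumber-diagonal : ∀ k n → coronaNumber k n n ≡ 1
coronaNumber-diagonal k zero    = refl
coronaNumber-diagonal k (suc n) = begin
  coronaNumber k n (suc n) + coronaNumber k n n + k * n * coronaNumber k (pred n) n
    ≡⟨ cong₂ (λ x y → x + y + k * n * coronaNumber k (pred n) n)
             (coronaNumber-above k n (suc n) ≤-refl) (coronaNumber-diagonal k n) ⟩
  1 + k * n * coronaNumber k (pred n) n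
    ≡⟨ cong suc (pendant-term-vanishes n) ⟩
  1 ∎
  where
  open ≡-Reasoning
  pendant-term-vanishes : ∀ n → k * n * coronaNumber k (pred n) n ≡ 0
  pendant-term-vanishes zero    = cong (_* 1) (*-zeroʳ k)
  pendant-term-vanishes (suc n) = trans (cong (k * suc n *_) (coronaNumber-above k n (suc n) ≤-refl)) (*-zeroʳ (k * suc n))

coronaNumber-table : ∀ k m r → coronaNumber k (m + r) m ≡ coronaTable k m r
coronaNumber-table k zero    r       = refl
coronaNumber-table k (suc m) zero    = trans (cong (λ n → coronaNumber k n (suc m)) (+-identityʳ (suc m))) (coronaNumber-diagonal k (suc m))
coronaNumber-table k (suc m) (suc r) = begin
  N (m + suc r) (suc m) + N (m + suc r) m + k * (m + suc r) * N (pred (m + suc r)) m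
    ≡⟨ cong (λ n → N n (suc m) + N (m + suc r) m + k * n * N (pred n) m) (+-suc m r) ⟩
  N (suc m + r) (suc m) + N (m + suc r) m + k * suc (m + r) * N (m + r) m
    ≡⟨ cong₂ _+_ (cong₂ _+_ (coronaNumber-table k (suc m) r) (coronaNumber-table k m (suc r)))
                 (cong (k * suc (m + r) *_) (coronaNumber-table k m r)) ⟩
  coronaTable k (suc m) r + coronaTable k m (suc r) + k * suc (m + r) * coronaTable k m r ∎
  where
  open ≡-Reasoning
  N = coronaNumber k

coronaNumber-table-∸ : ∀ k {p m} → m ≤ p → coronaNumber k p m ≡ coronaTable k m (p ∸ m)
coronaNumber-table-∸ k {p} {m} m≤p = trans (cong (λ n → coronaNumber k n m) (sym (m+[n∸m]≡n m≤p))) (coronaNumber-table k m (p ∸ m))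

coronaNumber-symmetric : ∀ k p → Symmetric (coronaNumber k p) p
coronaNumber-symmetric k p m m≤p = begin
  coronaNumber k p m              ≡⟨ coronaNumber-table-∸ k m≤p ⟩
  coronaTable k m (p ∸ m)         ≡⟨ coronaTable-sym k m (p ∸ m) ⟩
  coronaTable k (p ∸ m) m         ≡⟨ cong (coronaTable k (p ∸ m)) (sym (m∸[m∸n]≡n m≤p)) ⟩
  coronaTable k (p ∸ m) (p ∸ (p ∸ m)) ≡⟨ sym (coronaNumber-table-∸ k (m∸n≤m p m)) ⟩
  coronaNumber k p (p ∸ m)        ∎
  where open ≡-Reasoning

coronaNumber-positive : ∀ k {p m} → m ≤ p → 0 < coronaNumber k p m
coronaNumber-positive k {p} {m} m≤p = subst (0 <_) (sym (coronaNumber-table-∸ k m≤p)) (coronaTable-positive k m (p ∸ m))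

coronaNumber-ultraLogConcave : ∀ {k w} → k * w ≡ 2 → ∀ p → UltraLogConcave (coronaNumber k p) p
coronaNumber-ultraLogConcave {k} {w} k*w≡2 p (suc i) _ i<p with m≤n⇒∃[o]m+o≡n i<p
... | o , refl = subst₂ _≤_ (sym outer) (sym inner) (coronaTable-ultraLogConcave {k} {w} k*w≡2 i o)
  where
  N = coronaNumber k (2 + i + o)
  T = coronaTable k
  at : ∀ m r → m + r ≡ 2 + i + o → N m ≡ T m r
  at m r m+r≡p = subst (λ n → coronaNumber k n m ≡ T m r) m+r≡p (coronaNumber-table k m r)
  gap : 2 + i + o ∸ suc i ≡ suc o
  gap = trans (cong (_∸ i) (sym (+-suc i o))) (m+n∸m≡n i (suc o))
  outer : (suc i + 1) * ((2 + i + o ∸ suc i) + 1) * (N i * N (suc i + 1)) ≡ (2 + i) * (2 + o) * (T i (2 + o) * T (2 + i) o)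
  outer = cong₂ _*_ (cong₂ _*_ (+-comm (suc i) 1) (trans (cong (_+ 1) gap) (+-comm (suc o) 1)))
                    (cong₂ _*_ (at i (2 + o) (trans (+-suc i (suc o)) (cong suc (+-suc i o))))
                               (trans (cong N (+-comm (suc i) 1)) (at (2 + i) o refl)))
  inner : suc i * (2 + i + o ∸ suc i) * (N (suc i) * N (suc i)) ≡ (1 + i) * (1 + o) * (T (1 + i) (1 + o) * T (1 + i) (1 + o))
  inner = cong₂ _*_ (cong (suc i *_) gap) (cong₂ _*_ N₃ N₃)
    where
    N₃ = at (1 + i) (1 + o) (cong suc (+-suc i o))

coronaNumber-properties : ∀ {k w} → k * w ≡ 2 → ∀ p →
  Symmetric (coronaNumber k p) p × Unimodal (coronaNumber k p) p × UltraLogConcave (coronaNumber k p) p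
coronaNumber-properties {k} k*w≡2 p =
  coronaNumber-symmetric k p ,
  logConcave∧symmetric⇒unimodal (λ _ → coronaNumber-positive k) (ultraLogConcave⇒logConcave {coronaNumber k p} ulc) (coronaNumber-symmetric k p) ,
  ulc
  where ulc = coronaNumber-ultraLogConcave k*w≡2 p

copies : ∀ {A : Set} → ℕ → List A → List A
copies k xs = concat (replicate k xs)

module _ {A : Set} where

  filterᵇ-map : ∀ {B : Set} (P : B → Bool) (f : A → B) xs → filterᵇ P (map f xs) ≡ map f (filterᵇ (P ∘ f) xs)
  filterᵇ-map P f []       = refl
  filterᵇ-map P f (x ∷ xs) with P (f x)
  ... | true  = cong (f x ∷_) (filterᵇ-map P f xs)
  ... | false = filterᵇ-map P f xs

  filterᵇ-filterᵇ : ∀ (P Q : A → Bool) xs → filterᵇ P (filterᵇ Q xs) ≡ filterᵇ (λ x → Q x ∧ P x) xs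
  filterᵇ-filterᵇ P Q []       = refl
  filterᵇ-filterᵇ P Q (x ∷ xs) with Q x
  ... | false = filterᵇ-filterᵇ P Q xs
  ... | true with P x
  ...   | true  = cong (x ∷_) (filterᵇ-filterᵇ P Q xs)
  ...   | false = filterᵇ-filterᵇ P Q xs

  filterᵇ-cong : ∀ {P Q : A → Bool} → P ≗ Q → filterᵇ P ≗ filterᵇ Q
  filterᵇ-cong P≗Q []       = refl
  filterᵇ-cong {P} {Q} P≗Q (x ∷ xs) with P x | Q x | P≗Q x
  ... | true  | true  | refl = cong (x ∷_) (filterᵇ-cong P≗Q xs)
  ... | false | false | refl = filterᵇ-cong P≗Q xs

  filterᵇ-comm : ∀ (P Q : A → Bool) xs → filterᵇ P (filterᵇ Q xs) ≡ filterᵇ Q (filterᵇ P xs)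
  filterᵇ-comm P Q xs = trans (filterᵇ-filterᵇ P Q xs)
    (trans (filterᵇ-cong (λ x → ∧-comm (Q x) (P x)) xs) (sym (filterᵇ-filterᵇ Q P xs)))

  filterᵇ-all : ∀ {P : A → Bool} → (∀ x → P x ≡ true) → filterᵇ P ≗ (λ xs → xs)
  filterᵇ-all P≡true []       = refl
  filterᵇ-all {P} P≡true (x ∷ xs) with P x | P≡true x
  ... | true | refl = cong (x ∷_) (filterᵇ-all P≡true xs)

  filterᵇ-none : ∀ {P : A → Bool} {xs} → All (λ x → P x ≡ false) xs → filterᵇ P xs ≡ []
  filterᵇ-none [] = refl
  filterᵇ-none {P} {x ∷ xs} (Px≡false ∷ rest) with P x | Px≡false
  ... | false | refl = filterᵇ-none rest

  filterᵇ-accept : ∀ {P : A → Bool} {x} xs → P x ≡ true → filterᵇ P (x ∷ xs) ≡ x ∷ filterᵇ P xs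
  filterᵇ-accept {P} {x} xs Px≡true with P x | Px≡true
  ... | true | refl = refl

  filterᵇ-satisfies : ∀ (P : A → Bool) xs → All (λ x → P x ≡ true) (filterᵇ P xs)
  filterᵇ-satisfies P []       = []
  filterᵇ-satisfies P (x ∷ xs) with P x in Px
  ... | true  = Px ∷ filterᵇ-satisfies P xs
  ... | false = filterᵇ-satisfies P xs

  filter-≟true≗filterᵇ : ∀ (P : A → Bool) → filter (λ x → P x Bool.≟ true) ≗ filterᵇ P
  filter-≟true≗filterᵇ P []       = refl
  filter-≟true≗filterᵇ P (x ∷ xs) with P x
  ... | true  = cong (x ∷_) (filter-≟true≗filterᵇ P xs)
  ... | false = filter-≟true≗filterᵇ P xs

  copies-[] : ∀ k → copies {A} k [] ≡ []
  copies-[] zero    = refl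
  copies-[] (suc k) = copies-[] k

  filterᵇ-copies : ∀ (P : A → Bool) k xs → filterᵇ P (copies k xs) ≡ copies k (filterᵇ P xs)
  filterᵇ-copies P zero    xs = refl
  filterᵇ-copies P (suc k) xs = trans (filter-++ _ xs (copies k xs)) (cong (filterᵇ P xs ++_) (filterᵇ-copies P k xs))

  map-copies : ∀ {B : Set} (f : A → B) k xs → map f (copies k xs) ≡ copies k (map f xs)
  map-copies f zero    xs = refl
  map-copies f (suc k) xs = trans (map-++ f xs (copies k xs)) (cong (map f xs ++_) (map-copies f k xs))

  All-copies : ∀ {P : A → Set} k {xs} → All P xs → All P (copies k xs)
  All-copies zero    Pxs = []
  All-copies (suc k) Pxs = All-++⁺ Pxs (All-copies k Pxs)

  sum-map-copies : ∀ (f : A → ℕ) k xs → sum (map f (copies k xs)) ≡ k * sum (map f xs)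
  sum-map-copies f zero    xs = refl
  sum-map-copies f (suc k) xs = begin
    sum (map f (xs ++ copies k xs))                 ≡⟨ cong sum (map-++ f xs (copies k xs)) ⟩
    sum (map f xs ++ map f (copies k xs))           ≡⟨ sum-++ (map f xs) (map f (copies k xs)) ⟩
    sum (map f xs) + sum (map f (copies k xs))      ≡⟨ cong (sum (map f xs) +_) (sum-map-copies f k xs) ⟩
    sum (map f xs) + k * sum (map f xs)             ∎
    where open ≡-Reasoning

  sum-map-const : ∀ {f : A → ℕ} {c xs} → All (λ x → f x ≡ c) xs → sum (map f xs) ≡ length xs * c
  sum-map-const []               = refl
  sum-map-const (fx≡c ∷ fxs≡c) = cong₂ _+_ fx≡c (sum-map-const fxs≡c)

  copies-++-↭ : ∀ k (xs ys : List A) → copies k (xs ++ ys) ↭ copies k xs ++ copies k ys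
  copies-++-↭ zero    xs ys = ↭.refl
  copies-++-↭ (suc k) xs ys = begin
    (xs ++ ys) ++ copies k (xs ++ ys)   ↭⟨ ↭ₚ.++⁺ˡ (xs ++ ys) (copies-++-↭ k xs ys) ⟩
    (xs ++ ys) ++ (cxs ++ cys)          ≡⟨ ++-assoc xs ys (cxs ++ cys) ⟩
    xs ++ (ys ++ (cxs ++ cys))          ≡⟨ cong (xs ++_) (sym (++-assoc ys cxs cys)) ⟩
    xs ++ ((ys ++ cxs) ++ cys)          ↭⟨ ↭ₚ.++⁺ˡ xs (↭ₚ.++⁺ʳ cys (↭ₚ.++-comm ys cxs)) ⟩
    xs ++ ((cxs ++ ys) ++ cys)          ≡⟨ cong (xs ++_) (++-assoc cxs ys cys) ⟩
    xs ++ (cxs ++ (ys ++ cys))          ≡⟨ sym (++-assoc xs cxs (ys ++ cys)) ⟩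
    (xs ++ cxs) ++ (ys ++ cys)          ∎
    where
    open PermutationReasoning
    cxs = copies k xs
    cys = copies k ys

  copies-split-↭ : ∀ k (xs ys : List A) z zs → copies k (xs ++ ys) ++ z ∷ zs ↭ (copies k xs ++ [ z ]) ++ (copies k ys ++ zs)
  copies-split-↭ k xs ys z zs = begin
    copies k (xs ++ ys) ++ z ∷ zs       ↭⟨ ↭ₚ.++⁺ʳ (z ∷ zs) (copies-++-↭ k xs ys) ⟩
    (cxs ++ cys) ++ z ∷ zs              ≡⟨ ++-assoc cxs cys (z ∷ zs) ⟩
    cxs ++ (cys ++ z ∷ zs)              ↭⟨ ↭ₚ.++⁺ˡ cxs (↭ₚ.shift z cys zs) ⟩
    cxs ++ (z ∷ cys ++ zs)              ≡⟨ sym (++-assoc cxs [ z ] (cys ++ zs)) ⟩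
    (cxs ++ [ z ]) ++ (cys ++ zs)       ∎
    where
    open PermutationReasoning
    cxs = copies k xs
    cys = copies k ys

choose-filterᵇ : ∀ {A : Set} (P : A → Bool) m xs → filterᵇ (allB P) (choose m xs) ≡ choose m (filterᵇ P xs)
choose-filterᵇ P zero    xs       = refl
choose-filterᵇ P (suc m) []       = refl
choose-filterᵇ P (suc m) (x ∷ xs) = begin
  filterᵇ (allB P) (map (x ∷_) (choose m xs) ++ choose (suc m) xs)
    ≡⟨ filter-++ _ (map (x ∷_) (choose m xs)) (choose (suc m) xs) ⟩
  filterᵇ (allB P) (map (x ∷_) (choose m xs)) ++ filterᵇ (allB P) (choose (suc m) xs)
    ≡⟨ cong₂ _++_ (filterᵇ-map (allB P) (x ∷_) (choose m xs)) (choose-filterᵇ P (suc m) xs) ⟩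
  map (x ∷_) (filterᵇ (λ S → P x ∧ allB P S) (choose m xs)) ++ choose (suc m) (filterᵇ P xs)
    ≡⟨ by-head ⟩
  choose (suc m) (filterᵇ P (x ∷ xs)) ∎
  where
  open ≡-Reasoning
  by-head : map (x ∷_) (filterᵇ (λ S → P x ∧ allB P S) (choose m xs)) ++ choose (suc m) (filterᵇ P xs)
            ≡ choose (suc m) (filterᵇ P (x ∷ xs))
  by-head with P x
  ... | true  = cong (λ C → map (x ∷_) C ++ choose (suc m) (filterᵇ P xs)) (choose-filterᵇ P m xs)
  ... | false = cong (λ C → map (x ∷_) C ++ choose (suc m) (filterᵇ P xs)) (filterᵇ-none (universal (λ _ → refl) (choose m xs)))

choose-map : ∀ {A B : Set} (g : A → B) m xs → choose m (map g xs) ≡ map (map g) (choose m xs)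
choose-map g zero    xs       = refl
choose-map g (suc m) []       = refl
choose-map g (suc m) (x ∷ xs) = begin
  map (g x ∷_) (choose m (map g xs)) ++ choose (suc m) (map g xs)
    ≡⟨ cong₂ _++_ (cong (map (g x ∷_)) (choose-map g m xs)) (choose-map g (suc m) xs) ⟩
  map (g x ∷_) (map (map g) (choose m xs)) ++ map (map g) (choose (suc m) xs)
    ≡⟨ cong (_++ map (map g) (choose (suc m) xs)) (trans (sym (map-∘ (choose m xs))) (map-∘ (choose m xs))) ⟩
  map (map g) (map (x ∷_) (choose m xs)) ++ map (map g) (choose (suc m) xs)
    ≡⟨ sym (map-++ (map g) (map (x ∷_) (choose m xs)) (choose (suc m) xs)) ⟩
  map (map g) (map (x ∷_) (choose m xs) ++ choose (suc m) xs) ∎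
  where open ≡-Reasoning

-- Counting matchings of an edge list

module _ {q : ℕ} where

  ==-refl : ∀ (x : Vertex q) → (x == x) ≡ true
  ==-refl x = dec-true (≡-dec Fin._≟_ Fin._≟_ x x) refl

  ==-sym : ∀ (x y : Vertex q) → (x == y) ≡ (y == x)
  ==-sym x y = does-⇔ (mk⇔ sym sym) (≡-dec Fin._≟_ Fin._≟_ x y) (≡-dec Fin._≟_ Fin._≟_ y x)

  disjoint-sym : ∀ (e f : Edge q) → disjoint e f ≡ disjoint f e
  disjoint-sym (a , b) (c , d) rewrite ==-sym c a | ==-sym c b | ==-sym d a | ==-sym d b =
    swap-middle (not (a == c)) (not (a == d)) (not (b == c)) (not (b == d))
    where
    swap-middle : ∀ w x y z → w ∧ x ∧ y ∧ z ≡ w ∧ y ∧ x ∧ z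
    swap-middle true  true  y z = refl
    swap-middle true  false true  z = refl
    swap-middle true  false false z = refl
    swap-middle false x y z = refl

  disjoint-shared : ∀ {e f : Edge q} → proj₁ e ≡ proj₁ f → disjoint e f ≡ false
  disjoint-shared {a , b} {.a , d} refl rewrite ==-refl a = refl

  countMatchings-filterᵇ : ∀ m (es : List (Edge q)) → countMatchings m es ≡ length (filterᵇ isMatching (choose m es))
  countMatchings-filterᵇ m es = cong length (filter-≟true≗filterᵇ isMatching (choose m es))

  countMatchings-cons : ∀ m (e : Edge q) es →
    countMatchings (suc m) (e ∷ es) ≡ countMatchings m (filterᵇ (disjoint e) es) + countMatchings (suc m) es
  countMatchings-cons m e es = begin
    countMatchings (suc m) (e ∷ es)
      ≡⟨ countMatchings-filterᵇ (suc m) (e ∷ es) ⟩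
    length (filterᵇ isMatching (map (e ∷_) C ++ D))
      ≡⟨ cong length (filter-++ _ (map (e ∷_) C) D) ⟩
    length (filterᵇ isMatching (map (e ∷_) C) ++ filterᵇ isMatching D)
      ≡⟨ length-++ (filterᵇ isMatching (map (e ∷_) C)) ⟩
    length (filterᵇ isMatching (map (e ∷_) C)) + length (filterᵇ isMatching D)
      ≡⟨ cong₂ _+_ containing-e (sym (countMatchings-filterᵇ (suc m) es)) ⟩
    countMatchings m (filterᵇ (disjoint e) es) + countMatchings (suc m) es ∎
    where
    open ≡-Reasoning
    C = choose m es
    D = choose (suc m) es
    containing-e : length (filterᵇ isMatching (map (e ∷_) C)) ≡ countMatchings m (filterᵇ (disjoint e) es)
    containing-e = begin
      length (filterᵇ isMatching (map (e ∷_) C))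
        ≡⟨ cong length (filterᵇ-map isMatching (e ∷_) C) ⟩
      length (map (e ∷_) (filterᵇ (λ S → allB (disjoint e) S ∧ isMatching S) C))
        ≡⟨ length-map (e ∷_) (filterᵇ (λ S → allB (disjoint e) S ∧ isMatching S) C) ⟩
      length (filterᵇ (λ S → allB (disjoint e) S ∧ isMatching S) C)
        ≡⟨ cong length (sym (filterᵇ-filterᵇ isMatching (allB (disjoint e)) C)) ⟩
      length (filterᵇ isMatching (filterᵇ (allB (disjoint e)) C))
        ≡⟨ cong (length ∘ filterᵇ isMatching) (choose-filterᵇ (disjoint e) m es) ⟩
      length (filterᵇ isMatching (choose m (filterᵇ (disjoint e) es)))
        ≡⟨ sym (countMatchings-filterᵇ m (filterᵇ (disjoint e) es)) ⟩
      countMatchings m (filterᵇ (disjoint e) es) ∎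

  countMatchings-cons₂ : ∀ m (x y : Edge q) zs → countMatchings (suc m) (x ∷ y ∷ zs)
    ≡ countMatchings m (filterᵇ (disjoint x) (y ∷ zs)) + countMatchings m (filterᵇ (disjoint y) zs) + countMatchings (suc m) zs
  countMatchings-cons₂ m x y zs = trans (countMatchings-cons m x (y ∷ zs))
    (trans (cong (countMatchings m (filterᵇ (disjoint x) (y ∷ zs)) +_) (countMatchings-cons m y zs))
           (sym (+-assoc (countMatchings m (filterᵇ (disjoint x) (y ∷ zs))) _ _)))

  countMatchings-↭ : ∀ m {xs ys : List (Edge q)} → xs ↭ ys → countMatchings m xs ≡ countMatchings m ys
  countMatchings-↭ zero    _              = refl
  countMatchings-↭ (suc m) ↭.refl         = refl
  countMatchings-↭ (suc m) (↭.trans p p′) = trans (countMatchings-↭ (suc m) p) (countMatchings-↭ (suc m) p′)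
  countMatchings-↭ (suc m) {x ∷ xs} {x ∷ ys} (↭.prep x p) = begin
    countMatchings (suc m) (x ∷ xs)                                        ≡⟨ countMatchings-cons m x xs ⟩
    countMatchings m (filterᵇ (disjoint x) xs) + countMatchings (suc m) xs ≡⟨ cong₂ _+_ (countMatchings-↭ m (↭ₚ.filter-↭ _ p)) (countMatchings-↭ (suc m) p) ⟩
    countMatchings m (filterᵇ (disjoint x) ys) + countMatchings (suc m) ys ≡⟨ sym (countMatchings-cons m x ys) ⟩
    countMatchings (suc m) (x ∷ ys)                                        ∎
    where open ≡-Reasoning
  -- Whether or not x and y share a vertex, expanding both heads gives the same terms.
  countMatchings-↭ (suc m) {x ∷ y ∷ xs} {y ∷ x ∷ ys} (↭.swap x y p) = begin
    countMatchings (suc m) (x ∷ y ∷ xs)                          ≡⟨ countMatchings-cons₂ m x y xs ⟩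
    cM m (F x (y ∷ xs)) + cM m (F y xs) + cM (suc m) xs          ≡⟨ cong₂ _+_ heads-swapped (countMatchings-↭ (suc m) p) ⟩
    cM m (F y (x ∷ ys)) + cM m (F x ys) + cM (suc m) ys          ≡⟨ sym (countMatchings-cons₂ m y x ys) ⟩
    countMatchings (suc m) (y ∷ x ∷ ys)                          ∎
    where
    open ≡-Reasoning
    cM = countMatchings
    F : Edge q → List (Edge q) → List (Edge q)
    F e = filterᵇ (disjoint e)
    filtered : ∀ e → F e xs ↭ F e ys
    filtered e = ↭ₚ.filter-↭ _ p
    heads-swapped : cM m (F x (y ∷ xs)) + cM m (F y xs) ≡ cM m (F y (x ∷ ys)) + cM m (F x ys)
    heads-swapped rewrite disjoint-sym y x with disjoint x y
    ... | false = trans (cong₂ _+_ (countMatchings-↭ m (filtered x)) (countMatchings-↭ m (filtered y))) (+-comm (cM m (F x ys)) (cM m (F y ys)))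
    ... | true  = heads-disjoint m
      where
      heads-disjoint : ∀ m → cM m (y ∷ F x xs) + cM m (F y xs) ≡ cM m (x ∷ F y ys) + cM m (F x ys)
      heads-disjoint zero     = refl
      heads-disjoint (suc m′) = begin
        cM (suc m′) (y ∷ F x xs) + cM (suc m′) (F y xs)
          ≡⟨ cong (_+ cM (suc m′) (F y xs)) (countMatchings-cons m′ y (F x xs)) ⟩
        cM m′ (F y (F x xs)) + cM (suc m′) (F x xs) + cM (suc m′) (F y xs)
          ≡⟨ cong₂ _+_ (cong₂ _+_ (countMatchings-↭ m′ filtered-twice) (countMatchings-↭ (suc m′) (filtered x)))
                       (countMatchings-↭ (suc m′) (filtered y)) ⟩
        cM m′ (F x (F y ys)) + cM (suc m′) (F x ys) + cM (suc m′) (F y ys)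
          ≡⟨ xy∙z≈xz∙y (cM m′ (F x (F y ys))) _ _ ⟩
        cM m′ (F x (F y ys)) + cM (suc m′) (F y ys) + cM (suc m′) (F x ys)
          ≡⟨ cong (_+ cM (suc m′) (F x ys)) (sym (countMatchings-cons m′ x (F y ys))) ⟩
        cM (suc m′) (x ∷ F y ys) + cM (suc m′) (F x ys) ∎
        where
        filtered-twice : F y (F x xs) ↭ F x (F y ys)
        filtered-twice = ↭.↭-trans (↭.↭-reflexive (filterᵇ-comm (disjoint y) (disjoint x) xs))
                                   (↭ₚ.filter-↭ _ (↭ₚ.filter-↭ _ p))

  countMatchings-star : ∀ m {u : Vertex q} {Es} R → All (λ e → proj₁ e ≡ u) Es →
    countMatchings (suc m) (Es ++ R)
      ≡ sum (map (λ e → countMatchings m (filterᵇ (disjoint e) R)) Es) + countMatchings (suc m) R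
  countMatchings-star m R []                  = refl
  countMatchings-star m {u} {e ∷ Es} R (e-at-u ∷ Es-at-u) = begin
    countMatchings (suc m) (e ∷ Es ++ R)
      ≡⟨ countMatchings-cons m e (Es ++ R) ⟩
    countMatchings m (filterᵇ (disjoint e) (Es ++ R)) + countMatchings (suc m) (Es ++ R)
      ≡⟨ cong₂ _+_ (cong (countMatchings m) rest-of-star-removed) (countMatchings-star m R Es-at-u) ⟩
    countMatchings m (filterᵇ (disjoint e) R) + (sum (map (λ e → countMatchings m (filterᵇ (disjoint e) R)) Es) + countMatchings (suc m) R)
      ≡⟨ sym (+-assoc (countMatchings m (filterᵇ (disjoint e) R)) _ _) ⟩
    sum (map (λ e → countMatchings m (filterᵇ (disjoint e) R)) (e ∷ Es)) + countMatchings (suc m) R ∎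
    where
    open ≡-Reasoning
    rest-of-star-removed : filterᵇ (disjoint e) (Es ++ R) ≡ filterᵇ (disjoint e) R
    rest-of-star-removed = trans (filter-++ _ Es R) (cong (_++ filterᵇ (disjoint e) R)
      (filterᵇ-none {P = disjoint e} (All-map (λ {f} f-at-u → disjoint-shared {e = e} {f} (trans e-at-u (sym f-at-u))) Es-at-u)))

relabel : ∀ {q q′} → (Vertex q → Vertex q′) → Edge q → Edge q′
relabel f (a , b) = f a , f b

module _ {q q′} {f : Vertex q → Vertex q′} (f-reflects-== : ∀ x y → (f x == f y) ≡ (x == y)) where

  disjoint-relabel : ∀ e e′ → disjoint (relabel f e) (relabel f e′) ≡ disjoint e e′
  disjoint-relabel (a , b) (c , d)
    rewrite f-reflects-== a c | f-reflects-== a d | f-reflects-== b c | f-reflects-== b d = refl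

  isMatching-relabel : ∀ S → isMatching (map (relabel f) S) ≡ isMatching S
  isMatching-relabel []      = refl
  isMatching-relabel (e ∷ S) = cong₂ _∧_ (disjoint-from-e S) (isMatching-relabel S)
    where
    disjoint-from-e : ∀ S → allB (disjoint (relabel f e)) (map (relabel f) S) ≡ allB (disjoint e) S
    disjoint-from-e []       = refl
    disjoint-from-e (e′ ∷ S) = cong₂ _∧_ (disjoint-relabel e e′) (disjoint-from-e S)

  countMatchings-relabel : ∀ m es → countMatchings m (map (relabel f) es) ≡ countMatchings m es
  countMatchings-relabel m es = begin
    countMatchings m (map (relabel f) es)
      ≡⟨ countMatchings-filterᵇ m (map (relabel f) es) ⟩
    length (filterᵇ isMatching (choose m (map (relabel f) es)))
      ≡⟨ cong (length ∘ filterᵇ isMatching) (choose-map (relabel f) m es) ⟩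
    length (filterᵇ isMatching (map (map (relabel f)) (choose m es)))
      ≡⟨ cong length (filterᵇ-map isMatching (map (relabel f)) (choose m es)) ⟩
    length (map (map (relabel f)) (filterᵇ (isMatching ∘ map (relabel f)) (choose m es)))
      ≡⟨ length-map (map (relabel f)) (filterᵇ (isMatching ∘ map (relabel f)) (choose m es)) ⟩
    length (filterᵇ (isMatching ∘ map (relabel f)) (choose m es))
      ≡⟨ cong length (filterᵇ-cong isMatching-relabel (choose m es)) ⟩
    length (filterᵇ isMatching (choose m es))
      ≡⟨ sym (countMatchings-filterᵇ m es) ⟩
    countMatchings m es ∎
    where open ≡-Reasoning

-- The corona graphs

module _ {q : ℕ} where

  liftV : Vertex q → Vertex (suc q)
  liftV = Sum.map fsuc fsuc

  liftV-reflects-== : ∀ x y → (liftV x == liftV y) ≡ (x == y)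
  liftV-reflects-== (inj₁ i) (inj₁ j) = refl
  liftV-reflects-== (inj₁ i) (inj₂ j) = refl
  liftV-reflects-== (inj₂ i) (inj₁ j) = refl
  liftV-reflects-== (inj₂ i) (inj₂ j) = refl

  liftE : Edge q → Edge (suc q)
  liftE = relabel liftV

  spoke : Fin q → Edge (suc q)
  spoke j = inj₁ fzero , inj₁ (fsuc j)

  pendant₀ : Edge (suc q)
  pendant₀ = inj₁ fzero , inj₂ fzero

  removed : (Fin q → Bool) → Vertex q → Bool
  removed S (inj₁ i) = S i
  removed S (inj₂ i) = false

  keeps : (Fin q → Bool) → Edge q → Bool
  keeps S (x , y) = not (removed S x) ∧ not (removed S y)

  _∪_ : (Fin q → Bool) → (Fin q → Bool) → Fin q → Bool
  (S ∪ T) i = S i ∨ T i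

  ⁅_⁆ : Fin q → Fin q → Bool
  ⁅ j ⁆ i = does (j Fin.≟ i)

  keeps-∪ : ∀ S T e → keeps S e ∧ keeps T e ≡ keeps (S ∪ T) e
  keeps-∪ S T (x , y) = de-morgan (removed S x) (removed S y) (removed T x) (removed T y) (removed-∪ x) (removed-∪ y)
    where
    removed-∪ : ∀ x → removed (S ∪ T) x ≡ removed S x ∨ removed T x
    removed-∪ (inj₁ i) = refl
    removed-∪ (inj₂ i) = refl
    de-morgan : ∀ a b c d {s t} → s ≡ a ∨ c → t ≡ b ∨ d → (not a ∧ not b) ∧ (not c ∧ not d) ≡ not s ∧ not t
    de-morgan true  b     c     d     refl refl = refl
    de-morgan false true  c     d     refl refl = sym (∧-zeroʳ (not c))
    de-morgan false false true  d     refl refl = refl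
    de-morgan false false false true  refl refl = refl
    de-morgan false false false false refl refl = refl

allFin-suc : ∀ q → allFin (suc q) ≡ fzero ∷ map fsuc (allFin q)
allFin-suc q = cong (fzero ∷_) (sym (map-tabulate id fsuc))

ordered : ∀ {p} → Fin p → Fin p → List (Edge p)
ordered i j = if does (i <? j) then [ (inj₁ i , inj₁ j) ] else []

vvEdges-ordered : ∀ p → vvEdges p ≡ concatMap (λ i → concatMap (ordered i) (allFin p)) (allFin p)
vvEdges-ordered p = concatMap-cong (λ i → concatMap-cong (pick≡ordered i) (allFin p)) (allFin p)
  where
  -- The row builder of vvEdges is local to its definition; unification recovers it.
  pick : Fin p → Fin p → List (Edge p)
  pick = proj₁ {B = λ K → vvEdges p ≡ concatMap (λ i → concatMap (K i) (allFin p)) (allFin p)} (_ , refl)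
  pick≡ordered : ∀ i j → pick i j ≡ ordered i j
  pick≡ordered i j with does (i <? j)
  ... | true  = refl
  ... | false = refl

ordered-suc : ∀ {p} (i j : Fin p) → ordered (fsuc i) (fsuc j) ≡ map liftE (ordered i j)
ordered-suc i j with does (i <? j)
... | true  = refl
... | false = refl

vvEdges-suc : ∀ q → vvEdges (suc q) ≡ map spoke (allFin q) ++ map liftE (vvEdges q)
vvEdges-suc q = begin
  vvEdges (suc q)
    ≡⟨ vvEdges-ordered (suc q) ⟩
  concatMap row (allFin (suc q))
    ≡⟨ cong (concatMap row) (allFin-suc q) ⟩
  row fzero ++ concatMap row (map fsuc (allFin q))
    ≡⟨ cong₂ _++_ first-row (concatMap-map row fsuc (allFin q)) ⟩
  map spoke (allFin q) ++ concatMap (row ∘ fsuc) (allFin q)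
    ≡⟨ cong (map spoke (allFin q) ++_) (concatMap-cong later-row (allFin q)) ⟩
  map spoke (allFin q) ++ concatMap (map liftE ∘ row′) (allFin q)
    ≡⟨ cong (map spoke (allFin q) ++_) (sym (map-concatMap liftE row′ (allFin q))) ⟩
  map spoke (allFin q) ++ map liftE (concatMap row′ (allFin q))
    ≡⟨ cong (λ es → map spoke (allFin q) ++ map liftE es) (sym (vvEdges-ordered q)) ⟩
  map spoke (allFin q) ++ map liftE (vvEdges q) ∎
  where
  open ≡-Reasoning
  row : Fin (suc q) → List (Edge (suc q))
  row i = concatMap (ordered i) (allFin (suc q))
  row′ : Fin q → List (Edge q)
  row′ i = concatMap (ordered i) (allFin q)
  first-row : row fzero ≡ map spoke (allFin q)
  first-row = begin
    concatMap (ordered fzero) (allFin (suc q))           ≡⟨ cong (concatMap (ordered fzero)) (allFin-suc q) ⟩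
    concatMap (ordered fzero) (map fsuc (allFin q))      ≡⟨ concatMap-map (ordered fzero) fsuc (allFin q) ⟩
    concatMap ([_] ∘ spoke) (allFin q)                   ≡⟨ sym (concatMap-map [_] spoke (allFin q)) ⟩
    concatMap [_] (map spoke (allFin q))                 ≡⟨ concatMap-pure (map spoke (allFin q)) ⟩
    map spoke (allFin q)                                 ∎
  later-row : ∀ i → row (fsuc i) ≡ map liftE (row′ i)
  later-row i = begin
    concatMap (ordered (fsuc i)) (allFin (suc q))        ≡⟨ cong (concatMap (ordered (fsuc i))) (allFin-suc q) ⟩
    concatMap (ordered (fsuc i)) (map fsuc (allFin q))   ≡⟨ concatMap-map (ordered (fsuc i)) fsuc (allFin q) ⟩
    concatMap (ordered (fsuc i) ∘ fsuc) (allFin q)       ≡⟨ concatMap-cong (ordered-suc i) (allFin q) ⟩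
    concatMap (map liftE ∘ ordered i) (allFin q)         ≡⟨ sym (map-concatMap liftE (ordered i) (allFin q)) ⟩
    map liftE (row′ i)                                   ∎

vwEdges-suc : ∀ q → vwEdges (suc q) ≡ pendant₀ ∷ map liftE (vwEdges q)
vwEdges-suc q = cong (pendant₀ ∷_) (begin
  map pendant (tabulate fsuc)          ≡⟨ cong (map pendant) (sym (map-tabulate id fsuc)) ⟩
  map pendant (map fsuc (allFin q))    ≡⟨ sym (map-∘ (allFin q)) ⟩
  map (liftE ∘ pendant) (allFin q)     ≡⟨ map-∘ (allFin q) ⟩
  map liftE (vwEdges q)                ∎)
  where
  open ≡-Reasoning
  pendant : ∀ {p} → Fin p → Edge p
  pendant i = inj₁ i , inj₂ i

#kept : ∀ {q} → (Fin q → Bool) → ℕ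
#kept {zero}  S = 0
#kept {suc q} S = (if S fzero then 0 else 1) + #kept (S ∘ fsuc)

#kept-cong : ∀ {q} {S T : Fin q → Bool} → S ≗ T → #kept S ≡ #kept T
#kept-cong {zero}          S≗T = refl
#kept-cong {suc q} {S} {T} S≗T =
  cong₂ (λ b n → (if b then 0 else 1) + n) (S≗T fzero) (#kept-cong (S≗T ∘ fsuc))

#kept-none : ∀ q → #kept {q} (λ _ → false) ≡ q
#kept-none zero    = refl
#kept-none (suc q) = cong suc (#kept-none q)

#kept-remove : ∀ {q} (S : Fin q → Bool) j → S j ≡ false → #kept S ≡ suc (#kept (S ∪ ⁅ j ⁆))
#kept-remove {suc q} S fzero    Sj≡false rewrite Sj≡false =
  cong suc (#kept-cong (λ i → sym (∨-identityʳ (S (fsuc i)))))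
#kept-remove {suc q} S (fsuc j) Sj≡false rewrite ∨-identityʳ (S fzero) =
  trans (cong ((if S fzero then 0 else 1) +_) (#kept-remove (S ∘ fsuc) j Sj≡false)) (+-suc _ _)

length-kept : ∀ {q} (S : Fin q → Bool) → length (filterᵇ (not ∘ S) (allFin q)) ≡ #kept S
length-kept-tail : ∀ {q} (S : Fin (suc q) → Bool) → length (filterᵇ (not ∘ S) (map fsuc (allFin q))) ≡ #kept (S ∘ fsuc)

length-kept {zero}  S = refl
length-kept {suc q} S with S fzero | trans (cong (length ∘ filterᵇ (not ∘ S)) (sym (map-tabulate id fsuc))) (length-kept-tail S)
... | true  | rest = rest
... | false | rest = cong suc rest

length-kept-tail {q} S = begin
  length (filterᵇ (not ∘ S) (map fsuc (allFin q)))       ≡⟨ cong length (filterᵇ-map (not ∘ S) fsuc (allFin q)) ⟩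
  length (map fsuc (filterᵇ (not ∘ S ∘ fsuc) (allFin q))) ≡⟨ length-map fsuc (filterᵇ (not ∘ S ∘ fsuc) (allFin q)) ⟩
  length (filterᵇ (not ∘ S ∘ fsuc) (allFin q))            ≡⟨ length-kept (S ∘ fsuc) ⟩
  #kept (S ∘ fsuc)                                         ∎
  where open ≡-Reasoning

-- The k-fold corona on q vertices with each vᵢ, S i = true, removed; wᵢ stays as an isolated vertex.
corona : ℕ → ∀ q → (Fin q → Bool) → List (Edge q)
corona k q S = filterᵇ (keeps S) (copies k (vvEdges q) ++ vwEdges q)

module _ {q : ℕ} where

  keeps-liftE : ∀ (S : Fin (suc q) → Bool) e → keeps S (liftE e) ≡ keeps (S ∘ fsuc) e
  keeps-liftE S (inj₁ a , inj₁ b) = refl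
  keeps-liftE S (inj₁ a , inj₂ b) = refl
  keeps-liftE S (inj₂ a , inj₁ b) = refl
  keeps-liftE S (inj₂ a , inj₂ b) = refl

  disjoint-spoke-liftE : ∀ (j : Fin q) (e : Edge q) → disjoint (spoke j) (liftE e) ≡ keeps ⁅ j ⁆ e
  disjoint-spoke-liftE j (inj₁ a , inj₁ b) = refl
  disjoint-spoke-liftE j (inj₁ a , inj₂ b) = refl
  disjoint-spoke-liftE j (inj₂ a , inj₁ b) = refl
  disjoint-spoke-liftE j (inj₂ a , inj₂ b) = refl

  disjoint-pendant₀-liftE : ∀ (e : Edge q) → disjoint pendant₀ (liftE e) ≡ true
  disjoint-pendant₀-liftE (inj₁ a , inj₁ b) = refl
  disjoint-pendant₀-liftE (inj₁ a , inj₂ b) = refl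
  disjoint-pendant₀-liftE (inj₂ a , inj₁ b) = refl
  disjoint-pendant₀-liftE (inj₂ a , inj₂ b) = refl

  keeps-none : ∀ e → keeps {q} (λ _ → false) e ≡ true
  keeps-none (inj₁ a , inj₁ b) = refl
  keeps-none (inj₁ a , inj₂ b) = refl
  keeps-none (inj₂ a , inj₁ b) = refl
  keeps-none (inj₂ a , inj₂ b) = refl

  filterᵇ-keeps-liftE : ∀ (S : Fin (suc q) → Bool) es →
    filterᵇ (keeps S) (map liftE es) ≡ map liftE (filterᵇ (keeps (S ∘ fsuc)) es)
  filterᵇ-keeps-liftE S es = trans (filterᵇ-map (keeps S) liftE es) (cong (map liftE) (filterᵇ-cong (keeps-liftE S) es))

  corona-∪ : ∀ k (S T : Fin q → Bool) → filterᵇ (keeps T) (corona k q S) ≡ corona k q (S ∪ T)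
  corona-∪ k S T = trans (filterᵇ-filterᵇ (keeps T) (keeps S) es) (filterᵇ-cong (keeps-∪ S T) es)
    where es = copies k (vvEdges q) ++ vwEdges q

  corona-suc : ∀ k (S : Fin (suc q) → Bool) →
    corona k (suc q) S ↭ filterᵇ (keeps S) (copies k (map spoke (allFin q)) ++ [ pendant₀ ]) ++ map liftE (corona k q (S ∘ fsuc))
  corona-suc k S = begin
    corona k (suc q) S
      ≡⟨ cong₂ (λ vv vw → filterᵇ (keeps S) (copies k vv ++ vw)) (vvEdges-suc q) (vwEdges-suc q) ⟩
    filterᵇ (keeps S) (copies k (spokes ++ map liftE VV) ++ pendant₀ ∷ map liftE VW)
      ↭⟨ ↭ₚ.filter-↭ _ (copies-split-↭ k spokes (map liftE VV) pendant₀ (map liftE VW)) ⟩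
    filterᵇ (keeps S) ((copies k spokes ++ [ pendant₀ ]) ++ (copies k (map liftE VV) ++ map liftE VW))
      ≡⟨ filter-++ _ (copies k spokes ++ [ pendant₀ ]) _ ⟩
    filterᵇ (keeps S) (copies k spokes ++ [ pendant₀ ]) ++ filterᵇ (keeps S) (copies k (map liftE VV) ++ map liftE VW)
      ≡⟨ cong (filterᵇ (keeps S) (copies k spokes ++ [ pendant₀ ]) ++_) lifted ⟩
    filterᵇ (keeps S) (copies k spokes ++ [ pendant₀ ]) ++ map liftE (corona k q (S ∘ fsuc)) ∎
    where
    open PermutationReasoning
    spokes = map spoke (allFin q)
    VV = vvEdges q
    VW = vwEdges q
    lifted : filterᵇ (keeps S) (copies k (map liftE VV) ++ map liftE VW) ≡ map liftE (corona k q (S ∘ fsuc))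
    lifted = trans (cong (filterᵇ (keeps S)) (trans (cong (_++ map liftE VW) (sym (map-copies liftE k VV))) (sym (map-++ liftE (copies k VV) VW))))
                   (filterᵇ-keeps-liftE S (copies k VV ++ VW))

  star : ℕ → (Fin (suc q) → Bool) → List (Edge (suc q))
  star k S = filterᵇ (keeps S) (copies k (map spoke (allFin q)) ++ [ pendant₀ ])

  star-removed : ∀ k (S : Fin (suc q) → Bool) → S fzero ≡ true → star k S ≡ []
  star-removed k S S₀≡true = begin
    filterᵇ (keeps S) (copies k spokes ++ [ pendant₀ ])
      ≡⟨ filter-++ _ (copies k spokes) [ pendant₀ ] ⟩
    filterᵇ (keeps S) (copies k spokes) ++ filterᵇ (keeps S) [ pendant₀ ]
      ≡⟨ cong₂ _++_ (trans (filterᵇ-copies (keeps S) k spokes) (cong (copies k) spokes-removed)) pendant-removed ⟩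
    copies k [] ++ []
      ≡⟨ cong (_++ []) (copies-[] k) ⟩
    [] ∎
    where
    open ≡-Reasoning
    spokes = map spoke (allFin q)
    spokes-removed : filterᵇ (keeps S) spokes ≡ []
    spokes-removed = trans (filterᵇ-map (keeps S) spoke (allFin q))
      (cong (map spoke) (filterᵇ-none (universal (λ j → cong (λ b → not b ∧ not (S (fsuc j))) S₀≡true) (allFin q))))
    pendant-removed : filterᵇ (keeps S) [ pendant₀ ] ≡ []
    pendant-removed = filterᵇ-none {P = keeps S} {xs = [ pendant₀ ]} (cong (λ b → not b ∧ true) S₀≡true ∷ [])

  star-kept : ∀ k (S : Fin (suc q) → Bool) → S fzero ≡ false →
    star k S ≡ copies k (map spoke (filterᵇ (not ∘ S ∘ fsuc) (allFin q))) ++ [ pendant₀ ]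
  star-kept k S S₀≡false = begin
    filterᵇ (keeps S) (copies k spokes ++ [ pendant₀ ])
      ≡⟨ filter-++ _ (copies k spokes) [ pendant₀ ] ⟩
    filterᵇ (keeps S) (copies k spokes) ++ filterᵇ (keeps S) [ pendant₀ ]
      ≡⟨ cong₂ _++_ (trans (filterᵇ-copies (keeps S) k spokes) (cong (copies k) spokes-kept)) pendant-kept ⟩
    copies k (map spoke (filterᵇ (not ∘ S ∘ fsuc) (allFin q))) ++ [ pendant₀ ] ∎
    where
    open ≡-Reasoning
    spokes = map spoke (allFin q)
    spokes-kept : filterᵇ (keeps S) spokes ≡ map spoke (filterᵇ (not ∘ S ∘ fsuc) (allFin q))
    spokes-kept = trans (filterᵇ-map (keeps S) spoke (allFin q))
      (cong (map spoke) (filterᵇ-cong (λ j → cong (λ b → not b ∧ not (S (fsuc j))) S₀≡false) (allFin q)))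
    pendant-kept : filterᵇ (keeps S) [ pendant₀ ] ≡ [ pendant₀ ]
    pendant-kept = filterᵇ-accept {P = keeps S} [] (cong (λ b → not b ∧ true) S₀≡false)

module _ (k : ℕ) {q : ℕ} (count-q : ∀ (T : Fin q → Bool) m → countMatchings m (corona k q T) ≡ coronaNumber k (#kept T) m) where

  countMatchings-corona-removed : ∀ (S : Fin (suc q) → Bool) m → S fzero ≡ true →
    countMatchings m (corona k (suc q) S) ≡ coronaNumber k (#kept (S ∘ fsuc)) m
  countMatchings-corona-removed S m S₀≡true = begin
    countMatchings m (corona k (suc q) S)                         ≡⟨ countMatchings-↭ m (corona-suc k S) ⟩
    countMatchings m (star k S ++ map liftE (corona k q (S ∘ fsuc))) ≡⟨ cong (λ es → countMatchings m (es ++ map liftE (corona k q (S ∘ fsuc)))) (star-removed k S S₀≡true) ⟩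
    countMatchings m (map liftE (corona k q (S ∘ fsuc)))          ≡⟨ countMatchings-relabel liftV-reflects-== m _ ⟩
    countMatchings m (corona k q (S ∘ fsuc))                      ≡⟨ count-q (S ∘ fsuc) m ⟩
    coronaNumber k (#kept (S ∘ fsuc)) m                           ∎
    where open ≡-Reasoning

  countMatchings-avoiding-spoke : ∀ (S : Fin q → Bool) m j → S j ≡ false →
    countMatchings m (filterᵇ (disjoint (spoke j)) (map liftE (corona k q S))) ≡ coronaNumber k (pred (#kept S)) m
  countMatchings-avoiding-spoke S m j Sj≡false = begin
    countMatchings m (filterᵇ (disjoint (spoke j)) (map liftE G))
      ≡⟨ cong (countMatchings m) (trans (filterᵇ-map (disjoint (spoke j)) liftE G)
                                        (cong (map liftE) (filterᵇ-cong (disjoint-spoke-liftE j) G))) ⟩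
    countMatchings m (map liftE (filterᵇ (keeps ⁅ j ⁆) G))  ≡⟨ countMatchings-relabel liftV-reflects-== m _ ⟩
    countMatchings m (filterᵇ (keeps ⁅ j ⁆) G)              ≡⟨ cong (countMatchings m) (corona-∪ k S ⁅ j ⁆) ⟩
    countMatchings m (corona k q (S ∪ ⁅ j ⁆))               ≡⟨ count-q (S ∪ ⁅ j ⁆) m ⟩
    coronaNumber k (#kept (S ∪ ⁅ j ⁆)) m                    ≡⟨ cong (λ n → coronaNumber k (pred n) m) (sym (#kept-remove S j Sj≡false)) ⟩
    coronaNumber k (pred (#kept S)) m                       ∎
    where
    open ≡-Reasoning
    G = corona k q S

  countMatchings-avoiding-pendant₀ : ∀ (S : Fin q → Bool) m →
    countMatchings m (filterᵇ (disjoint pendant₀) (map liftE (corona k q S))) ≡ coronaNumber k (#kept S) m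
  countMatchings-avoiding-pendant₀ S m = begin
    countMatchings m (filterᵇ (disjoint pendant₀) (map liftE G))
      ≡⟨ cong (countMatchings m) (trans (filterᵇ-map (disjoint pendant₀) liftE G) (cong (map liftE) (filterᵇ-all disjoint-pendant₀-liftE G))) ⟩
    countMatchings m (map liftE G)  ≡⟨ countMatchings-relabel liftV-reflects-== m G ⟩
    countMatchings m G              ≡⟨ count-q S m ⟩
    coronaNumber k (#kept S) m      ∎
    where
    open ≡-Reasoning
    G = corona k q S

  sum-over-star : ∀ (S : Fin q → Bool) m → let n = #kept S; J = filterᵇ (not ∘ S) (allFin q) in
    sum (map (λ e → countMatchings m (filterᵇ (disjoint e) (map liftE (corona k q S)))) (copies k (map spoke J) ++ [ pendant₀ ]))
      ≡ k * (n * coronaNumber k (pred n) m) + coronaNumber k n m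
  sum-over-star S m = begin
    sum (map through (copies k (map spoke J) ++ [ pendant₀ ]))
      ≡⟨ cong sum (map-++ through (copies k (map spoke J)) [ pendant₀ ]) ⟩
    sum (map through (copies k (map spoke J)) ++ [ through pendant₀ ])
      ≡⟨ sum-++ (map through (copies k (map spoke J))) [ through pendant₀ ] ⟩
    sum (map through (copies k (map spoke J))) + (through pendant₀ + 0)
      ≡⟨ cong₂ _+_ (sum-map-copies through k (map spoke J)) (+-identityʳ (through pendant₀)) ⟩
    k * sum (map through (map spoke J)) + through pendant₀
      ≡⟨ cong₂ (λ x y → k * x + y) (cong sum (sym (map-∘ J))) (countMatchings-avoiding-pendant₀ S m) ⟩
    k * sum (map (through ∘ spoke) J) + coronaNumber k n m
      ≡⟨ cong (λ x → k * x + coronaNumber k n m) (sum-map-const spokes-equal) ⟩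
    k * (length J * coronaNumber k (pred n) m) + coronaNumber k n m
      ≡⟨ cong (λ x → k * (x * coronaNumber k (pred n) m) + coronaNumber k n m) (length-kept S) ⟩
    k * (n * coronaNumber k (pred n) m) + coronaNumber k n m ∎
    where
    open ≡-Reasoning
    n = #kept S
    J = filterᵇ (not ∘ S) (allFin q)
    through : Edge (suc q) → ℕ
    through e = countMatchings m (filterᵇ (disjoint e) (map liftE (corona k q S)))
    spokes-equal : All (λ j → through (spoke j) ≡ coronaNumber k (pred n) m) J
    spokes-equal = All-map (λ {j} kept → countMatchings-avoiding-spoke S m j (not-injective kept)) (filterᵇ-satisfies (not ∘ S) (allFin q))

  countMatchings-corona-kept : ∀ (S : Fin (suc q) → Bool) m → S fzero ≡ false →
    countMatchings (suc m) (corona k (suc q) S) ≡ coronaNumber k (suc (#kept (S ∘ fsuc))) (suc m)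
  countMatchings-corona-kept S m S₀≡false = begin
    countMatchings (suc m) (corona k (suc q) S)
      ≡⟨ countMatchings-↭ (suc m) (corona-suc k S) ⟩
    countMatchings (suc m) (star k S ++ L)
      ≡⟨ cong (λ es → countMatchings (suc m) (es ++ L)) (star-kept k S S₀≡false) ⟩
    countMatchings (suc m) ((copies k (map spoke J) ++ [ pendant₀ ]) ++ L)
      ≡⟨ countMatchings-star m L at-v₀ ⟩
    sum (map (λ e → countMatchings m (filterᵇ (disjoint e) L)) (copies k (map spoke J) ++ [ pendant₀ ])) + countMatchings (suc m) L
      ≡⟨ cong₂ _+_ (sum-over-star S′ m) (trans (countMatchings-relabel liftV-reflects-== (suc m) (corona k q S′)) (count-q S′ (suc m))) ⟩
    k * (n * coronaNumber k (pred n) m) + coronaNumber k n m + coronaNumber k n (suc m)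
      ≡⟨ recurrence k n (coronaNumber k (pred n) m) (coronaNumber k n m) (coronaNumber k n (suc m)) ⟩
    coronaNumber k (suc n) (suc m) ∎
    where
    open ≡-Reasoning
    S′ = S ∘ fsuc
    n = #kept S′
    L = map liftE (corona k q S′)
    J = filterᵇ (not ∘ S′) (allFin q)
    at-v₀ : All (λ e → proj₁ e ≡ inj₁ fzero) (copies k (map spoke J) ++ [ pendant₀ ])
    at-v₀ = All-++⁺ (All-copies k (All-map⁺ (universal (λ _ → refl) J))) (refl ∷ [])
    recurrence : ∀ k n x y z → k * (n * x) + y + z ≡ z + y + k * n * x
    recurrence = solve-∀

countMatchings-corona : ∀ k q (S : Fin q → Bool) m → countMatchings m (corona k q S) ≡ coronaNumber k (#kept S) m
countMatchings-corona k q       S zero    = refl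
countMatchings-corona k zero    S (suc m) = cong (λ es → countMatchings (suc m) (filterᵇ (keeps S) (es ++ []))) (copies-[] k)
countMatchings-corona k (suc q) S (suc m) with S fzero in S₀
... | true  = countMatchings-corona-removed k (countMatchings-corona k q) S (suc m) S₀
... | false = countMatchings-corona-kept k (countMatchings-corona k q) S m S₀

countMatchings-copies : ∀ k p m → countMatchings m (copies k (vvEdges p) ++ vwEdges p) ≡ coronaNumber k p m
countMatchings-copies k p m = begin
  countMatchings m (copies k (vvEdges p) ++ vwEdges p)   ≡⟨ cong (countMatchings m) (sym (filterᵇ-all keeps-none _)) ⟩
  countMatchings m (corona k p (λ _ → false))           ≡⟨ countMatchings-corona k p (λ _ → false) m ⟩
  coronaNumber k (#kept {p} (λ _ → false)) m             ≡⟨ cong (λ n → coronaNumber k n m) (#kept-none p) ⟩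
  coronaNumber k p m                                     ∎
  where open ≡-Reasoning

a≗coronaNumber : ∀ p m → a p m ≡ coronaNumber 1 p m
a≗coronaNumber p m = trans (cong (λ vv → countMatchings m (vv ++ vwEdges p)) (sym (++-identityʳ (vvEdges p)))) (countMatchings-copies 1 p m)

c≗coronaNumber : ∀ p m → c p m ≡ coronaNumber 2 p m
c≗coronaNumber p m = trans (cong (countMatchings m) (trans (sym (++-assoc (vvEdges p) (vvEdges p) (vwEdges p)))
                                   (cong (λ vv → (vvEdges p ++ vv) ++ vwEdges p) (sym (++-identityʳ (vvEdges p))))))
                           (countMatchings-copies 2 p m)

proposition6p2 : (p : ℕ) → 0 < p →
    (Symmetric (a p) p × Unimodal (a p) p × UltraLogConcave (a p) p)
    × (Symmetric (c p) p × Unimodal (c p) p × UltraLogConcave (c p) p)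
-- The statement holds for p = 0 as well.
proposition6p2 p _ = properties-resp-≗ (a≗coronaNumber p) (coronaNumber-properties {1} {2} refl p)
                   , properties-resp-≗ (c≗coronaNumber p) (coronaNumber-properties {2} {1} refl p)
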